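{- Let $\mathcal T$ be a finite rooted tree with at least one edge whose nodes are labelled by pairwise distinct letters, and let $E$ be a construct of the hypergraph $\mathbb G(\mathcal T)$ all of whose node labels are singletons except exactly one, which is a two-element set $\{u,v\}$. Let $V_u$ (resp. $V_v$) be the construction with $V_u\le E$ (resp. $V_v\le E$) in which the node labelled $\{u\}$ is the parent of the node labelled $\{v\}$ (resp. the node $\{v\}$ is the parent of $\{u\}$). Then: (i) if the shortest path between $u$ and $v$ in $\mathbb G(\mathcal T)$ consists only of solid edges, then $u$ and $v$ have different levels, and, naming them so that the level of $u$ is smaller than the level of $v$, the word $\Phi^{ -1}(V_u)$ is obtained from $\Phi^{ -1}(V_v)$ by replacing one occurrence of a subword of the form $(s_1s_2)s_3$ by $s_1(s_2s_3)$, where $s_1,s_2,s_3$ are fully parenthesised words; (ii) otherwise (the shortest path contains a dashed edge), one of the words $\Phi^{ -1}(V_u),\Phi^{ -1}(V_v)$ is obtained from the other by replacing one occurrence of a subword of the form $(s_1s_2)s_3$ by $(s_1s_3)s_2$, where $s_1,s_2,s_3$ are fully parenthesised words.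
   Context: Hypergraphs: a hypergraph on a finite set $H$ is a set $\mathbf H\subseteq\mathcal P(H)\setminus\{\emptyset\}$ with $\bigcup\mathbf H=H$, atomic if it contains all singletons. $\mathbf H_X=\{Z\in\mathbf H:Z\subseteq X\}$; $\mathbf H$ is connected if there is no partition of $H$ into two non-empty disjoint $X_1,X_2$ with $\mathbf H=\mathbf H_{X_1}\cup\mathbf H_{X_2}$; $\mathbf H,X\leadsto H_1,\dots,H_n$ means $H_1,\dots,H_n$ are the connected components of $\mathbf H_{H\setminus X}$, and $\mathbf H_i=\mathbf H_{H_i}$. Constructs of a connected $\mathbf H$: for non-empty $Y\subseteq H$, if $Y=H$ the one-node tree labelled $H$ is a construct; otherwise if $\mathbf H,Y\leadsto H_1,\dots,H_n$ and $T_i$ are constructs of $\mathbf H_i$, the rooted tree $Y(T_1,\dots,T_n)$ (root labelled $Y$, unordered subtrees $T_i$) is a construct. A construction is a construct with all labels singletons. The order $\le$ on constructs is the smallest reflexive transitive relation such that $Y(X(T_{11},\dots,T_{1m}),T_2,\dots,T_n)\le (Y\cup X)(T_{11},\dots,T_{1m},T_2,\dots,T_n)$ whenever $\mathbf H,Y\leadsto K_1,\dots,K_n$, $\emptyset\ne X\subseteq K_1$, $\mathbf K_1,X\leadsto H_{11},\dots,H_{1m}$ (with $T_{1j}$, $T_i$ constructs of $\mathbf H_{1j}$, $\mathbf K_i$), and such that $Y(T_1,T_2,\dots,T_n)\le Y(T_1',T_2,\dots,T_n)$ whenever $T_1\le T_1'$ in $\mathbf H_1$ (where $\mathbf H,Y\leadsto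 H_1,\dots,H_n$). It is known that for $E$ as in the claim there are exactly two constructions below $E$, namely $V_u$ and $V_v$ as described. The graph $\mathbb G(\mathcal T)$: its vertices are the edges of $\mathcal T$; two vertices are adjacent iff, as edges of $\mathcal T$, they share a node. It is viewed as the atomic hypergraph consisting of all singletons and all adjacent pairs; it is connected. The level of a vertex $e$ is the depth in $\mathcal T$ of the child endpoint of $e$ (root has depth $0$). An edge $\{e,f\}$ of $\mathbb G(\mathcal T)$ is solid if the common node of $e,f$ is the child endpoint of one and the parent endpoint of the other (levels differ by $1$), and dashed if it is the parent endpoint of both (same level). Between any two vertices there is a unique shortest path. Words: fully parenthesised words over the letters of $\mathcal T$ are given by $w::=a\mid (ww)$. For a tree $\mathcal S$ whose nodes are distinct letters, a letter $a$ is admissible for the one-node tree $a$, and $(w_1w_2)$ is admissible for $\mathcal S$ if there is an edge $x$ of $\mathcal S$ such that, deleting $x$, $w_1$ is admissible for the component $\mathcal S_1$ containing the root of $\mathcal S$ and $w_2$ is admissible for the component $\mathcal S_2$ (the subtree rooted at the child endpoint of $x$); $x$ is the grafting edge. For an admissible word $w=(w_1w_2)$ for a subtree $\mathcal S$ of $\mathcal T$ with grafting edge $x$, define $\Phi(w)=x(\Phi(w_1),\Phi(w_2))$, where $\Phi(w_i)$ is omitted when $w_i$ is a single letter. $\Phi$ is a bijection from the words admissible for $\mathcal T$ onto the constructions of $\mathbb G(\mathcal T)$ (labels $x$ written for $\{x\}$). -}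

module Defs where

open import Data.Nat using (ℕ; zero; suc; _≤_)
import Data.Nat as ℕ
open import Data.Product using (Σ; ∃; ∃-syntax; _×_; _,_)
open import Data.Product.Properties using (≡-dec)
open import Data.Sum using (_⊎_)
open import Data.Unit using (⊤)
open import Data.List using (List; []; _∷_; _++_; [_]; map; filter)
open import Data.List.Membership.Propositional using (_∈_; _∉_)
import Data.List.Membership.DecPropositional as DecMem
open import Data.List.Relation.Unary.All using (All)
open import Data.List.Relation.Unary.Any using (Any)
open import Data.List.Relation.Unary.AllPairs using (AllPairs)
open import Data.List.Relation.Binary.Pointwise using (Pointwise)
open import Relation.Binary.PropositionalEquality using (_≡_; _≢_)
open import Relation.Binary.Definitions using (DecidableEquality)
open import Relation.Nullary using (¬_; ¬?)

-- Finite sets are represented by lists, read up to membership.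

module _ {V : Set} where

  _⊆_ : List V → List V → Set
  A ⊆ B = ∀ {x} → x ∈ A → x ∈ B

  _≐_ : List V → List V → Set
  A ≐ B = A ⊆ B × B ⊆ A

  NonEmpty : List V → Set
  NonEmpty A = ∃[ x ] x ∈ A

  Disjoint : List V → List V → Set
  Disjoint A B = ∀ {x} → x ∈ A → x ∉ B

  Singleton : List V → Set
  Singleton A = ∃[ x ] A ≐ [ x ]

-- Raw labelled rooted trees with unordered children (read up to _≈_
-- below): candidates for constructs.  node Y Ts = Y(T₁,…,Tₙ).

data Cons (V : Set) : Set where
  node : List V → List (Cons V) → Cons V

rootLabel : ∀ {V} → Cons V → List V
rootLabel (node Y _) = Y

-- Hypergraphs, constructs, and the order on constructs.
-- 𝐇 : List V → Set  says which (finite) sets are hyperedges.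
-- A vertex set S (a list) stands for the restricted hypergraph 𝐇_S.

module Hypergraph {V : Set} (_≟_ : DecidableEquality V) (𝐇 : List V → Set) where

  open DecMem _≟_ using (_∈?_)

  _∖_ : List V → List V → List V
  S ∖ Y = filter (λ x → ¬? (x ∈? Y)) S

  Connected : List V → Set
  Connected C =
    ¬ (Σ (List V) λ X₁ → Σ (List V) λ X₂ →
         NonEmpty X₁ × NonEmpty X₂ × Disjoint X₁ X₂ ×
         X₁ ⊆ C × X₂ ⊆ C × (∀ {x} → x ∈ C → x ∈ X₁ ⊎ x ∈ X₂) ×
         (∀ Z → 𝐇 Z → Z ⊆ C → Z ⊆ X₁ ⊎ Z ⊆ X₂))

  Components : List V → List (List V) → Set
  Components X Cs =
    All (λ C → NonEmpty C × C ⊆ X × Connected C) Cs ×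
    AllPairs Disjoint Cs ×
    (∀ {x} → x ∈ X → Any (x ∈_) Cs) ×
    (∀ Z → 𝐇 Z → Z ⊆ X → Any (Z ⊆_) Cs)

  -- T is a construct of 𝐇_S.  (When Y = S, S ∖ Y is empty, hence it has no
  -- components and T is the one-node tree Y.)
  data IsConstruct : List V → Cons V → Set where
    construct : ∀ {S Y Ts} (Cs : List (List V)) →
                NonEmpty Y → Y ⊆ S → Components (S ∖ Y) Cs →
                Pointwise IsConstruct Cs Ts →
                IsConstruct S (node Y Ts)

  -- identity of constructs: same labels (as sets), children up to
  -- permutation (children are unordered)
  mutual
    data _≈_ : Cons V → Cons V → Set where
      node : ∀ {Y Y' Ts Ts'} → Y ≐ Y' → Ts ≈* Ts' → node Y Ts ≈ node Y' Ts'

    data _≈*_ : List (Cons V) → List (Cons V) → Set where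
      []  : [] ≈* []
      _∷_ : ∀ {T T' Ts As Bs} → T ≈ T' → Ts ≈* (As ++ Bs) →
            (T ∷ Ts) ≈* (As ++ T' ∷ Bs)

  data _⊢_≤_ : List V → Cons V → Cons V → Set where
    ≤-refl  : ∀ {S T T'} → IsConstruct S T → T ≈ T' → S ⊢ T ≤ T'
    ≤-trans : ∀ {S T₁ T₂ T₃} → S ⊢ T₁ ≤ T₂ → S ⊢ T₂ ≤ T₃ → S ⊢ T₁ ≤ T₃
    ≤-merge : ∀ {S Y X K₁ Ks Hs T₁s T₂s} →
              NonEmpty Y → Y ⊆ S → Components (S ∖ Y) (K₁ ∷ Ks) →
              NonEmpty X → X ⊆ K₁ → Components (K₁ ∖ X) Hs →
              Pointwise IsConstruct Hs T₁s → Pointwise IsConstruct Ks T₂s →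
              S ⊢ node Y (node X T₁s ∷ T₂s) ≤ node (Y ++ X) (T₁s ++ T₂s)
    ≤-cong  : ∀ {S Y H₁ Hs T₁ T₁' Ts} →
              NonEmpty Y → Y ⊆ S → Components (S ∖ Y) (H₁ ∷ Hs) →
              H₁ ⊢ T₁ ≤ T₁' → Pointwise IsConstruct Hs Ts →
              S ⊢ node Y (T₁ ∷ Ts) ≤ node Y (T₁' ∷ Ts)

  data AllSingleton : Cons V → Set where
    node : ∀ {Y Ts} → Singleton Y → All AllSingleton Ts → AllSingleton (node Y Ts)

  IsConstruction : List V → Cons V → Set
  IsConstruction S T = IsConstruct S T × AllSingleton T

  data OneDoubleton (u v : V) : Cons V → Set where
    here  : ∀ {Y Ts} → Y ≐ (u ∷ v ∷ []) → All AllSingleton Ts →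
            OneDoubleton u v (node Y Ts)
    there : ∀ {Y As T Bs} → Singleton Y → All AllSingleton As →
            OneDoubleton u v T → All AllSingleton Bs →
            OneDoubleton u v (node Y (As ++ T ∷ Bs))

  data ParentOf (a b : V) : Cons V → Set where
    here  : ∀ {Y Ts} → Y ≐ [ a ] → Any (λ C → rootLabel C ≐ [ b ]) Ts →
            ParentOf a b (node Y Ts)
    there : ∀ {Y Ts} → Any (ParentOf a b) Ts → ParentOf a b (node Y Ts)

Letter : Set
Letter = ℕ

data Tree : Set where
  node : Letter → List Tree → Tree

root : Tree → Letter
root (node a _) = a

mutual
  letters : Tree → List Letter
  letters (node a ts) = a ∷ lettersL ts

  lettersL : List Tree → List Letter
  lettersL []       = []
  lettersL (t ∷ ts) = letters t ++ lettersL ts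

-- an edge of a tree is the pair (parent endpoint , child endpoint)
TEdge : Set
TEdge = Letter × Letter

mutual
  edges : Tree → List TEdge
  edges (node a ts) = map (λ s → (a , root s)) ts ++ edgesL ts

  edgesL : List Tree → List TEdge
  edgesL []       = []
  edgesL (t ∷ ts) = edges t ++ edgesL ts

data Depth : Tree → Letter → ℕ → Set where
  atRoot : ∀ {a ts} → Depth (node a ts) a 0
  child : ∀ {a ts b d} → Any (λ s → Depth s b d) ts → Depth (node a ts) b (suc d)

-- level of a vertex e of 𝔾(𝒯): depth of its child endpoint
Level : Tree → TEdge → ℕ → Set
Level t (p , c) d = Depth t c d

_≟E_ : DecidableEquality TEdge
_≟E_ = ≡-dec ℕ._≟_ ℕ._≟_

ShareNode : TEdge → TEdge → Set
ShareNode (p , c) (p' , c') = p ≡ p' ⊎ p ≡ c' ⊎ c ≡ p' ⊎ c ≡ c'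

Adj : Tree → TEdge → TEdge → Set
Adj t e f = e ∈ edges t × f ∈ edges t × e ≢ f × ShareNode e f

-- the atomic hypergraph: all singletons and all adjacent pairs
𝔾 : Tree → List TEdge → Set
𝔾 t Z = (∃[ e ] e ∈ edges t × Z ≐ [ e ])
      ⊎ (∃[ e ] ∃[ f ] Adj t e f × Z ≐ (e ∷ f ∷ []))

Solid : TEdge → TEdge → Set
Solid (p , c) (p' , c') = c ≡ p' ⊎ c' ≡ p

data Walk (t : Tree) : TEdge → TEdge → Set where
  []  : ∀ {e} → e ∈ edges t → Walk t e e
  _∷_ : ∀ {e f g} → Adj t e f → Walk t f g → Walk t e g

walkLength : ∀ {t e f} → Walk t e f → ℕ
walkLength ([] _)  = 0
walkLength (_ ∷ w) = suc (walkLength w)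

Geodesic : ∀ {t e f} → Walk t e f → Set
Geodesic {t} {e} {f} w = (w' : Walk t e f) → walkLength w ≤ walkLength w'

AllSolid : ∀ {t e f} → Walk t e f → Set
AllSolid ([] _) = ⊤
AllSolid (_∷_ {e} {f} _ w) = Solid e f × AllSolid w

infixl 5 _·_
data Word : Set where
  ltr : Letter → Word
  _·_ : Word → Word → Word

-- Cut S x S₁ S₂ : x is an edge of S; deleting it leaves the component S₁
-- containing the root of S and the subtree S₂ rooted at the child endpoint
data Cut : Tree → TEdge → Tree → Tree → Set where
  here  : ∀ {p As s Bs} →
          Cut (node p (As ++ s ∷ Bs)) (p , root s) (node p (As ++ Bs)) s
  there : ∀ {a As s Bs x s₁ s₂} → Cut s x s₁ s₂ →
          Cut (node a (As ++ s ∷ Bs)) x (node a (As ++ s₁ ∷ Bs)) s₂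

data Admissible : Word → Tree → Set where
  ltr   : ∀ {a} → Admissible (ltr a) (node a [])
  graft : ∀ {S x S₁ S₂ w₁ w₂} → Cut S x S₁ S₂ →
          Admissible w₁ S₁ → Admissible w₂ S₂ → Admissible (w₁ · w₂) S

mutual
  Φ : ∀ {w₁ w₂ S} → Admissible (w₁ · w₂) S → Cons TEdge
  Φ (graft {x = x} _ a₁ a₂) = node [ x ] (Φs a₁ ++ Φs a₂)

  Φs : ∀ {w S} → Admissible w S → List (Cons TEdge)
  Φs ltr = []
  Φs (graft c a₁ a₂) = [ Φ (graft c a₁ a₂) ]

data AssocStep : Word → Word → Set where
  here  : ∀ {s₁ s₂ s₃} → AssocStep ((s₁ · s₂) · s₃) (s₁ · (s₂ · s₃))
  left  : ∀ {w w' z} → AssocStep w w' → AssocStep (w · z) (w' · z)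
  right : ∀ {w w' z} → AssocStep w w' → AssocStep (z · w) (z · w')

data TwistStep : Word → Word → Set where
  here  : ∀ {s₁ s₂ s₃} → TwistStep ((s₁ · s₂) · s₃) ((s₁ · s₃) · s₂)
  left  : ∀ {w w' z} → TwistStep w w' → TwistStep (w · z) (w' · z)
  right : ∀ {w w' z} → TwistStep w w' → TwistStep (z · w) (z · w')

module Submission where

-- Under Φ, Below becomes the grafting order of an admissible word
--    (Grafted), and an admissible word is determined by its tree and this order.
--  * Descending simultaneously in the derivations of Φ⁻¹(Vu) and Φ⁻¹(Vv), the
--    words agree until the node carrying u and v; there the shape of the cuts
--    forces an associativity step (u, v comparable by ancestry) or a twist
--    (u, v incomparable).
--  * Geometry of 𝔾(𝒯).  A geodesic between u and v is all solid iff one of them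
--    is an ancestor edge of the other, and then their levels are ordered.

open import Defs
open import Data.Nat using (ℕ; zero; suc; _+_; _≤_; _≰_; _<_; z≤n; s≤s)
import Data.Nat.Properties as ℕₚ
open import Data.Empty using (⊥; ⊥-elim)
open import Data.Unit using (⊤; tt)
open import Data.Product using (Σ; _×_; _,_; proj₁; proj₂)
open import Data.Product.Properties using (×-≡,≡→≡)
open import Data.Sum using (_⊎_; inj₁; inj₂; [_,_]′)
open import Data.List using (List; []; _∷_; _++_; [_]; map; filter)
open import Data.List.Relation.Unary.Any using (Any; here; there; any?)
import Data.List.Relation.Unary.Any as Any
import Data.List.Relation.Unary.Any.Properties as AnyP
open import Data.List.Relation.Unary.All using (All; []; _∷_)
import Data.List.Relation.Unary.All as All
import Data.List.Relation.Unary.All.Properties as AllP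
open import Data.List.Relation.Unary.AllPairs using (AllPairs; []; _∷_)
open import Data.List.Relation.Binary.Pointwise using (Pointwise; []; _∷_)
open import Data.List.Relation.Unary.Unique.Propositional using (Unique)
open import Data.List.Membership.Propositional using (_∈_; _∉_; lose; find)
open import Data.List.Membership.Propositional.Properties using (∈-++⁺ˡ; ∈-++⁺ʳ; ∈-++⁻; ∈-filter⁺; ∈-filter⁻)
import Data.List.Membership.DecPropositional as DecMem
open import Function using (case_of_; _∘_)
open import Relation.Binary.PropositionalEquality hiding ([_])
open import Relation.Binary.Definitions using (DecidableEquality)
open import Relation.Nullary
open import Relation.Nullary.Decidable using (_×-dec_)

module _ {A : Set} where

  any-split : ∀ {P : A → Set} As {s Bs} → Any P (As ++ s ∷ Bs) → Any P As ⊎ P s ⊎ Any P Bs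
  any-split As a with AnyP.++⁻ As a
  ... | inj₁ q = inj₁ q
  ... | inj₂ (here q) = inj₂ (inj₁ q)
  ... | inj₂ (there q) = inj₂ (inj₂ q)

  any-after : ∀ {P : A → Set} As {s Bs} → Any P Bs → Any P (As ++ s ∷ Bs)
  any-after As a = AnyP.++⁺ʳ As (there a)

  any-at : ∀ {P : A → Set} As {s Bs} → P s → Any P (As ++ s ∷ Bs)
  any-at As p = AnyP.++⁺ʳ As (here p)

  any-insert : ∀ {P : A → Set} As {s Bs} → Any P (As ++ Bs) → Any P (As ++ s ∷ Bs)
  any-insert As a with AnyP.++⁻ As a
  ... | inj₁ q = AnyP.++⁺ˡ q
  ... | inj₂ q = any-after As q

  all-at-any : ∀ {P Q : A → Set} {xs} → All P xs → Any Q xs → Any (λ x → P x × Q x) xs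
  all-at-any (p ∷ _) (here q) = here (p , q)
  all-at-any (_ ∷ ps) (there q) = there (all-at-any ps q)

  all-remove : ∀ {P : A → Set} As {s Bs} → All P (As ++ s ∷ Bs) → All P (As ++ Bs) × P s
  all-remove [] (p ∷ ps) = ps , p
  all-remove (_ ∷ As) (p ∷ ps) = let (r , q) = all-remove As ps in p ∷ r , q

  all-insert : ∀ {P : A → Set} As {s Bs} → All P (As ++ Bs) → P s → All P (As ++ s ∷ Bs)
  all-insert [] ps p = p ∷ ps
  all-insert (_ ∷ As) (q ∷ ps) p = q ∷ all-insert As ps p

  allPairs-remove : ∀ {R : A → A → Set} As {s Bs} → AllPairs R (As ++ s ∷ Bs) →
                    AllPairs R (As ++ Bs) × All (λ t → R t s) As × All (R s) Bs
  allPairs-remove [] (r ∷ ap) = ap , [] , r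
  allPairs-remove (_ ∷ As) (r ∷ ap) =
    let (ap' , a1 , a2) = allPairs-remove As ap
        (r' , rs) = all-remove As r
    in r' ∷ ap' , rs ∷ a1 , a2

  allPairs-insert : ∀ {R : A → A → Set} As {s Bs} → AllPairs R (As ++ Bs) →
                    All (λ t → R t s) As → All (R s) Bs → AllPairs R (As ++ s ∷ Bs)
  allPairs-insert [] ap [] b = b ∷ ap
  allPairs-insert (_ ∷ As) (r ∷ ap) (q ∷ a1) b = all-insert As r q ∷ allPairs-insert As ap a1 b

  allPairs-++⁻ : ∀ {R : A → A → Set} xs {ys} → AllPairs R (xs ++ ys) →
                 AllPairs R xs × AllPairs R ys × (∀ {x y} → x ∈ xs → y ∈ ys → R x y)
  allPairs-++⁻ [] ap = [] , ap , λ ()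
  allPairs-++⁻ (x ∷ xs) (r ∷ ap) =
    let (a1 , a2 , f) = allPairs-++⁻ xs ap
    in (AllP.++⁻ˡ xs r ∷ a1) , a2 ,
       λ { (here refl) q → All.lookup (AllP.++⁻ʳ xs r) q ; (there p) q → f p q }

∈lettersL⁻ : ∀ {b} ts → b ∈ lettersL ts → Any (λ s → b ∈ letters s) ts
∈lettersL⁻ (t ∷ ts) p with ∈-++⁻ (letters t) p
... | inj₁ q = here q
... | inj₂ q = there (∈lettersL⁻ ts q)

∈lettersL⁺ : ∀ {b ts} → Any (λ s → b ∈ letters s) ts → b ∈ lettersL ts
∈lettersL⁺ (here q) = ∈-++⁺ˡ q
∈lettersL⁺ {ts = t ∷ _} (there q) = ∈-++⁺ʳ (letters t) (∈lettersL⁺ q)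

∈edgesL⁻ : ∀ {e} ts → e ∈ edgesL ts → Any (λ s → e ∈ edges s) ts
∈edgesL⁻ (t ∷ ts) p with ∈-++⁻ (edges t) p
... | inj₁ q = here q
... | inj₂ q = there (∈edgesL⁻ ts q)

∈edgesL⁺ : ∀ {e ts} → Any (λ s → e ∈ edges s) ts → e ∈ edgesL ts
∈edgesL⁺ (here q) = ∈-++⁺ˡ q
∈edgesL⁺ {ts = t ∷ _} (there q) = ∈-++⁺ʳ (edges t) (∈edgesL⁺ q)

∈letters⁻ : ∀ {b} a ts → b ∈ letters (node a ts) → b ≡ a ⊎ Any (λ s → b ∈ letters s) ts
∈letters⁻ a ts (here e) = inj₁ e
∈letters⁻ a ts (there p) = inj₂ (∈lettersL⁻ ts p)

∈letters⁺ : ∀ {b} a ts → Any (λ s → b ∈ letters s) ts → b ∈ letters (node a ts)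
∈letters⁺ a ts p = there (∈lettersL⁺ p)

root∈letters : ∀ t → root t ∈ letters t
root∈letters (node a _) = here refl

∈edges⁻ : ∀ {e} a ts → e ∈ edges (node a ts) → Any (λ s → e ≡ (a , root s)) ts ⊎ Any (λ s → e ∈ edges s) ts
∈edges⁻ a ts p with ∈-++⁻ (map (λ s → (a , root s)) ts) p
... | inj₁ q = inj₁ (AnyP.map⁻ q)
... | inj₂ q = inj₂ (∈edgesL⁻ ts q)

∈edges⁺-top : ∀ {e} a ts → Any (λ s → e ≡ (a , root s)) ts → e ∈ edges (node a ts)
∈edges⁺-top a ts p = ∈-++⁺ˡ (AnyP.map⁺ p)

∈edges⁺-sub : ∀ {e} a ts → Any (λ s → e ∈ edges s) ts → e ∈ edges (node a ts)
∈edges⁺-sub a ts p = ∈-++⁺ʳ (map (λ s → (a , root s)) ts) (∈edgesL⁺ p)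

top-edge-parent : ∀ {p c a : Letter} {ts : List Tree} → Any (λ s → (p , c) ≡ (a , root s)) ts → p ≡ a
top-edge-parent (here refl) = refl
top-edge-parent (there r) = top-edge-parent r

top-edge-child : ∀ {p c a : Letter} {ts : List Tree} → Any (λ s → (p , c) ≡ (a , root s)) ts → Any (λ s → c ≡ root s) ts
top-edge-child (here refl) = here refl
top-edge-child (there r) = there (top-edge-child r)

mutual
  parent∈letters : ∀ {p c} t → (p , c) ∈ edges t → p ∈ letters t
  parent∈letters (node a ts) q with ∈edges⁻ a ts q
  ... | inj₁ r = here (top-edge-parent r)
  ... | inj₂ r = ∈letters⁺ a ts (parent∈children r)

  parent∈children : ∀ {p c ts} → Any (λ s → (p , c) ∈ edges s) ts → Any (λ s → p ∈ letters s) ts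
  parent∈children (here q) = here (parent∈letters _ q)
  parent∈children (there q) = there (parent∈children q)

mutual
  child∈children : ∀ {p c} a ts → (p , c) ∈ edges (node a ts) → Any (λ s → c ∈ letters s) ts
  child∈children a ts q with ∈edges⁻ a ts q
  ... | inj₁ r = Any.map (λ {s} e → subst (_∈ letters s) (sym e) (root∈letters s)) (top-edge-child r)
  ... | inj₂ r = child∈children* r

  child∈children* : ∀ {p c ts} → Any (λ s → (p , c) ∈ edges s) ts → Any (λ s → c ∈ letters s) ts
  child∈children* {ts = node a ts ∷ _} (here q) = here (∈letters⁺ a ts (child∈children a ts q))
  child∈children* (there q) = there (child∈children* q)

child∈letters : ∀ {p c} t → (p , c) ∈ edges t → c ∈ letters t
child∈letters (node a ts) q = ∈letters⁺ a ts (child∈children a ts q)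

-- Trees with pairwise distinct letters, in inductive form: the root does not
-- occur in the children and the children have pairwise disjoint letters.

DisjointLetters : Tree → Tree → Set
DisjointLetters s t = ∀ {b} → b ∈ letters s → b ∉ letters t

data Distinct : Tree → Set where
  distinct : ∀ {a ts} → All Distinct ts → All (λ s → a ∉ letters s) ts →
             AllPairs DisjointLetters ts → Distinct (node a ts)

mutual
  unique⇒distinct : ∀ t → Unique (letters t) → Distinct t
  unique⇒distinct (node a ts) (na ∷ u) =
    let (w , d) = uniqueL⇒distinct ts u in
    distinct w (All.tabulate (λ {s} s∈ a∈ → All.lookup na (∈lettersL⁺ (Any.map (λ { refl → a∈ }) s∈)) refl)) d

  uniqueL⇒distinct : ∀ ts → Unique (lettersL ts) → All Distinct ts × AllPairs DisjointLetters ts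
  uniqueL⇒distinct [] _ = [] , []
  uniqueL⇒distinct (t ∷ ts) u =
    let (u1 , u2 , f) = allPairs-++⁻ (letters t) u
        (w , d) = uniqueL⇒distinct ts u2
    in unique⇒distinct t u1 ∷ w ,
       All.tabulate (λ {s} s∈ b∈t b∈s → f b∈t (∈lettersL⁺ (Any.map (λ { refl → b∈s }) s∈)) refl) ∷ d

root∉children : ∀ {a ts b} → Distinct (node a ts) → Any (λ s → b ∈ letters s) ts → b ≢ a
root∉children (distinct _ na _) p refl = AllP.All¬⇒¬Any na p

child≢root : ∀ {p c} t → Distinct t → (p , c) ∈ edges t → c ≢ root t
child≢root (node a ts) w q = root∉children w (child∈children a ts q)

parent≢child : ∀ {p c} t → Distinct t → (p , c) ∈ edges t → p ≢ c
parent≢child (node a ts) w@(distinct ws _ _) q e with ∈edges⁻ a ts q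
... | inj₁ r = root∉children w (child∈children a ts q) (trans (sym e) (top-edge-parent r))
... | inj₂ r = in-child ws r
  where
    in-child : ∀ {X} → All Distinct X → Any (λ s → (_ , _) ∈ edges s) X → ⊥
    in-child (w ∷ _) (here q) = parent≢child _ w q e
    in-child (_ ∷ ws) (there q) = in-child ws q

same-child : ∀ {ts b} {P Q : Tree → Set} → AllPairs DisjointLetters ts →
             Any (λ s → b ∈ letters s × P s) ts → Any (λ s → b ∈ letters s × Q s) ts →
             Any (λ s → P s × Q s) ts
same-child (_ ∷ _) (here (_ , p)) (here (_ , q)) = here (p , q)
same-child (d ∷ _) (here (b1 , _)) (there r) = ⊥-elim (All.lookupWith (λ d (b2 , _) → d b1 b2) d r)
same-child (d ∷ _) (there r) (here (b1 , _)) = ⊥-elim (All.lookupWith (λ d (b2 , _) → d b1 b2) d r)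
same-child (_ ∷ d) (there p) (there q) = there (same-child d p q)

record CutFacts (S : Tree) (x : TEdge) (S1 S2 : Tree) : Set where
  field
    root₂ : proj₂ x ≡ root S2
    root₁ : root S1 ≡ root S
    parent∈₁ : proj₁ x ∈ letters S1
    split : ∀ {e} → e ∈ edges S → e ≡ x ⊎ e ∈ edges S1 ⊎ e ∈ edges S2
    edge₁ : ∀ {e} → e ∈ edges S1 → e ∈ edges S
    edge₂ : ∀ {e} → e ∈ edges S2 → e ∈ edges S
    cut∈ : x ∈ edges S
    letter₁ : ∀ {b} → b ∈ letters S1 → b ∈ letters S
    letter₂ : ∀ {b} → b ∈ letters S2 → b ∈ letters S

cutFacts : ∀ {S x S1 S2} → Cut S x S1 S2 → CutFacts S x S1 S2
cutFacts (here {p} {As} {s} {Bs}) = record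
  { root₂ = refl ; root₁ = refl ; parent∈₁ = here refl ; split = split ; edge₁ = edge₁
  ; edge₂ = λ q → ∈edges⁺-sub p _ (any-at As q) ; cut∈ = ∈edges⁺-top p _ (any-at As refl)
  ; letter₁ = letter₁ ; letter₂ = λ q → ∈letters⁺ p _ (any-at As q) }
  where
    split : ∀ {e} → e ∈ edges (node p (As ++ s ∷ Bs)) → _
    split q with ∈edges⁻ p (As ++ s ∷ Bs) q
    ... | inj₁ r with any-split As r
    ...   | inj₁ ra = inj₂ (inj₁ (∈edges⁺-top p (As ++ Bs) (AnyP.++⁺ˡ ra)))
    ...   | inj₂ (inj₁ e) = inj₁ e
    ...   | inj₂ (inj₂ rb) = inj₂ (inj₁ (∈edges⁺-top p (As ++ Bs) (AnyP.++⁺ʳ As rb)))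
    split q | inj₂ r with any-split As r
    ...   | inj₁ ra = inj₂ (inj₁ (∈edges⁺-sub p (As ++ Bs) (AnyP.++⁺ˡ ra)))
    ...   | inj₂ (inj₁ e) = inj₂ (inj₂ e)
    ...   | inj₂ (inj₂ rb) = inj₂ (inj₁ (∈edges⁺-sub p (As ++ Bs) (AnyP.++⁺ʳ As rb)))
    edge₁ : ∀ {e} → e ∈ edges (node p (As ++ Bs)) → e ∈ edges (node p (As ++ s ∷ Bs))
    edge₁ q with ∈edges⁻ p (As ++ Bs) q
    ... | inj₁ r = ∈edges⁺-top p _ (any-insert As r)
    ... | inj₂ r = ∈edges⁺-sub p _ (any-insert As r)
    letter₁ : ∀ {b} → b ∈ letters (node p (As ++ Bs)) → b ∈ letters (node p (As ++ s ∷ Bs))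
    letter₁ q with ∈letters⁻ p (As ++ Bs) q
    ... | inj₁ refl = here refl
    ... | inj₂ r = ∈letters⁺ p _ (any-insert As r)
cutFacts (there {a} {As} {s} {Bs} {x} {s1} {s2} c) = record
  { root₂ = F.root₂ ; root₁ = refl ; parent∈₁ = ∈letters⁺ a (As ++ s1 ∷ Bs) (any-at As F.parent∈₁)
  ; split = split ; edge₁ = edge₁ ; edge₂ = λ q → ∈edges⁺-sub a _ (any-at As (F.edge₂ q))
  ; cut∈ = ∈edges⁺-sub a _ (any-at As F.cut∈) ; letter₁ = letter₁
  ; letter₂ = λ q → ∈letters⁺ a _ (any-at As (F.letter₂ q)) }
  where
    module F = CutFacts (cutFacts c)
    split : ∀ {e} → e ∈ edges (node a (As ++ s ∷ Bs)) → _
    split q with ∈edges⁻ a (As ++ s ∷ Bs) q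
    ... | inj₁ r with any-split As r
    ...   | inj₁ ra = inj₂ (inj₁ (∈edges⁺-top a _ (AnyP.++⁺ˡ ra)))
    ...   | inj₂ (inj₁ e) = inj₂ (inj₁ (∈edges⁺-top a _ (any-at As (trans e (cong (a ,_) (sym F.root₁))))))
    ...   | inj₂ (inj₂ rb) = inj₂ (inj₁ (∈edges⁺-top a _ (any-after As rb)))
    split q | inj₂ r with any-split As r
    ...   | inj₁ ra = inj₂ (inj₁ (∈edges⁺-sub a _ (AnyP.++⁺ˡ ra)))
    ...   | inj₂ (inj₂ rb) = inj₂ (inj₁ (∈edges⁺-sub a _ (any-after As rb)))
    ...   | inj₂ (inj₁ q') with F.split q'
    ...     | inj₁ e = inj₁ e
    ...     | inj₂ (inj₁ q1) = inj₂ (inj₁ (∈edges⁺-sub a _ (any-at As q1)))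
    ...     | inj₂ (inj₂ q2) = inj₂ (inj₂ q2)
    edge₁ : ∀ {e} → e ∈ edges (node a (As ++ s1 ∷ Bs)) → e ∈ edges (node a (As ++ s ∷ Bs))
    edge₁ q with ∈edges⁻ a (As ++ s1 ∷ Bs) q
    ... | inj₁ r with any-split As r
    ...   | inj₁ ra = ∈edges⁺-top a _ (AnyP.++⁺ˡ ra)
    ...   | inj₂ (inj₁ e) = ∈edges⁺-top a _ (any-at As (trans e (cong (a ,_) F.root₁)))
    ...   | inj₂ (inj₂ rb) = ∈edges⁺-top a _ (any-after As rb)
    edge₁ q | inj₂ r with any-split As r
    ...   | inj₁ ra = ∈edges⁺-sub a _ (AnyP.++⁺ˡ ra)
    ...   | inj₂ (inj₁ q') = ∈edges⁺-sub a _ (any-at As (F.edge₁ q'))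
    ...   | inj₂ (inj₂ rb) = ∈edges⁺-sub a _ (any-after As rb)
    letter₁ : ∀ {b} → b ∈ letters (node a (As ++ s1 ∷ Bs)) → b ∈ letters (node a (As ++ s ∷ Bs))
    letter₁ q with ∈letters⁻ a (As ++ s1 ∷ Bs) q
    ... | inj₁ refl = here refl
    ... | inj₂ r with any-split As r
    ...   | inj₁ ra = ∈letters⁺ a _ (AnyP.++⁺ˡ ra)
    ...   | inj₂ (inj₁ q') = ∈letters⁺ a _ (any-at As (F.letter₁ q'))
    ...   | inj₂ (inj₂ rb) = ∈letters⁺ a _ (any-after As rb)

cut-distinct : ∀ {S x S1 S2} → Cut S x S1 S2 → Distinct S →
               Distinct S1 × Distinct S2 × DisjointLetters S1 S2
cut-distinct (here {p} {As} {s} {Bs}) (distinct ws na ap) =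
  distinct (proj₁ (all-remove As ws)) (proj₁ (all-remove As na)) (proj₁ (allPairs-remove As ap)) ,
  proj₂ (all-remove As ws) , disjoint
  where
    disjoint : DisjointLetters (node p (As ++ Bs)) s
    disjoint {b} b1 b2 with ∈letters⁻ p (As ++ Bs) b1
    ... | inj₁ refl = proj₂ (all-remove As na) b2
    ... | inj₂ r with AnyP.++⁻ As r
    ...   | inj₁ ra = All.lookupWith (λ d q → d q b2) (proj₁ (proj₂ (allPairs-remove As ap))) ra
    ...   | inj₂ rb = All.lookupWith (λ d q → d b2 q) (proj₂ (proj₂ (allPairs-remove As ap))) rb
cut-distinct (there {a} {As} {s} {Bs} {x} {s1} {s2} c) (distinct ws na ap) =
  distinct (all-insert As (proj₁ (all-remove As ws)) w1)
           (all-insert As (proj₁ (all-remove As na)) (λ a∈ → a∉s (F.letter₁ a∈)))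
           (allPairs-insert As (proj₁ (allPairs-remove As ap))
              (All.map (λ d {_} b∈t b∈s1 → d b∈t (F.letter₁ b∈s1)) dA)
              (All.map (λ d {_} b∈s1 b∈t → d (F.letter₁ b∈s1) b∈t) dB)) ,
  w2 , disjoint
  where
    module F = CutFacts (cutFacts c)
    a∉s = proj₂ (all-remove As na)
    dA = proj₁ (proj₂ (allPairs-remove As ap))
    dB = proj₂ (proj₂ (allPairs-remove As ap))
    IH = cut-distinct c (proj₂ (all-remove As ws))
    w1 = proj₁ IH
    w2 = proj₁ (proj₂ IH)
    d12 = proj₂ (proj₂ IH)
    disjoint : DisjointLetters (node a (As ++ s1 ∷ Bs)) s2
    disjoint {b} b1 b2 with ∈letters⁻ a (As ++ s1 ∷ Bs) b1
    ... | inj₁ refl = a∉s (F.letter₂ b2)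
    ... | inj₂ r with any-split As r
    ...   | inj₁ ra = All.lookupWith (λ d q → d q (F.letter₂ b2)) dA ra
    ...   | inj₂ (inj₁ q) = d12 q b2
    ...   | inj₂ (inj₂ rb) = All.lookupWith (λ d q → d (F.letter₂ b2) q) dB rb

data Chain (E : List TEdge) : Letter → Letter → ℕ → Set where
  stay : ∀ {a} → Chain E a a 0
  link : ∀ {a b c n} → (a , b) ∈ E → Chain E b c n → Chain E a c (suc n)

Anc : List TEdge → Letter → Letter → Set
Anc E a b = Σ ℕ (Chain E a b)

chain-mono : ∀ {E E' a b n} → E ⊆ E' → Chain E a b n → Chain E' a b n
chain-mono f stay = stay
chain-mono f (link q r) = link (f q) (chain-mono f r)

anc-mono : ∀ {E E' a b} → E ⊆ E' → Anc E a b → Anc E' a b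
anc-mono f (n , r) = n , chain-mono f r

chain-snoc : ∀ {E a b c n} → Chain E a b n → (b , c) ∈ E → Chain E a c (suc n)
chain-snoc stay q = link q stay
chain-snoc (link q' r) q = link q' (chain-snoc r q)

chain-last : ∀ {E a c n} → Chain E a c (suc n) → Σ Letter λ b → Chain E a b n × (b , c) ∈ E
chain-last (link q stay) = _ , stay , q
chain-last (link q (link q' r)) = let (b , r' , e) = chain-last (link q' r) in b , link q r' , e

chain-++ : ∀ {E a b c n m} → Chain E a b n → Chain E b c m → Chain E a c (n + m)
chain-++ stay r = r
chain-++ (link q r) r' = link q (chain-++ r r')

anc-trans : ∀ {E a b c} → Anc E a b → Anc E b c → Anc E a c
anc-trans (n , r) (m , r') = n + m , chain-++ r r'

chain-end∈ : ∀ {a b n} t → Chain (edges t) a b n → a ∈ letters t → b ∈ letters t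
chain-end∈ t stay p = p
chain-end∈ t (link q r) p = chain-end∈ t r (child∈letters t q)

mutual
  root-anc : ∀ {b} t → b ∈ letters t → Anc (edges t) (root t) b
  root-anc (node a ts) p with ∈letters⁻ a ts p
  ... | inj₁ refl = 0 , stay
  ... | inj₂ r = root-anc* a ts r (λ q → q)

  root-anc* : ∀ {b} a ts {X} → Any (λ s → b ∈ letters s) X → (∀ {s} → s ∈ X → s ∈ ts) →
              Anc (edges (node a ts)) a b
  root-anc* a ts {s ∷ _} (here p) sub =
    let (n , r) = root-anc s p in
    suc n , link (∈edges⁺-top a ts (Any.map (λ { refl → refl }) (sub (here refl))))
                 (chain-mono (λ q → ∈edges⁺-sub a ts (Any.map (λ { refl → q }) (sub (here refl)))) r)
  root-anc* a ts (there p) sub = root-anc* a ts p (λ q → sub (there q))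

mutual
  depth∈ : ∀ {t b d} → Depth t b d → b ∈ letters t
  depth∈ {node a ts} atRoot = here refl
  depth∈ {node a ts} (child r) = ∈letters⁺ a ts (depth∈* r)

  depth∈* : ∀ {ts b d} → Any (λ s → Depth s b d) ts → Any (λ s → b ∈ letters s) ts
  depth∈* (here r) = here (depth∈ r)
  depth∈* (there r) = there (depth∈* r)

mutual
  depth-exists : ∀ {b} t → b ∈ letters t → Σ ℕ (Depth t b)
  depth-exists (node a ts) p with ∈letters⁻ a ts p
  ... | inj₁ refl = 0 , atRoot
  ... | inj₂ r = let (d , q) = depth-exists* r in suc d , child q

  depth-exists* : ∀ {b ts} → Any (λ s → b ∈ letters s) ts → Σ ℕ λ d → Any (λ s → Depth s b d) ts
  depth-exists* {ts = s ∷ _} (here p) = let (d , q) = depth-exists s p in d , here q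
  depth-exists* (there p) = let (d , q) = depth-exists* p in d , there q

mutual
  depth-unique : ∀ {t b d d'} → Distinct t → Depth t b d → Depth t b d' → d ≡ d'
  depth-unique w atRoot atRoot = refl
  depth-unique w atRoot (child r) = ⊥-elim (root∉children w (depth∈* r) refl)
  depth-unique w (child r) atRoot = ⊥-elim (root∉children w (depth∈* r) refl)
  depth-unique (distinct ws _ ap) (child r) (child r') =
    cong suc (depth-unique* ws (same-child ap (Any.map (λ q → depth∈ q , q) r) (Any.map (λ q → depth∈ q , q) r')))

  depth-unique* : ∀ {ts b d d'} → All Distinct ts → Any (λ s → Depth s b d × Depth s b d') ts → d ≡ d'
  depth-unique* (w ∷ _) (here (p , q)) = depth-unique w p q
  depth-unique* (_ ∷ ws) (there r) = depth-unique* ws r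

root-depth : ∀ s {c} → c ≡ root s → Depth s c 0
root-depth (node a _) refl = atRoot

mutual
  depth-edge : ∀ {t p c d} → Distinct t → (p , c) ∈ edges t → Depth t p d → Depth t c (suc d)
  depth-edge {node a ts} w q dp with ∈edges⁻ a ts q
  ... | inj₁ r = subst (λ d → Depth _ _ (suc d))
                       (sym (depth-unique w dp (subst (λ z → Depth _ z 0) (sym (top-edge-parent r)) atRoot)))
                       (child (Any.map (λ {s} e → root-depth s e) (top-edge-child r)))
  depth-edge {node a ts} w q atRoot | inj₂ r = ⊥-elim (root∉children w (parent∈children r) refl)
  depth-edge {node a ts} (distinct ws _ ap) q (child dp) | inj₂ r =
    child (depth-edge* ws (same-child ap (Any.map (λ q → parent∈letters _ q , q) r) (Any.map (λ q → depth∈ q , q) dp)))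

  depth-edge* : ∀ {ts p c d} → All Distinct ts → Any (λ s → (p , c) ∈ edges s × Depth s p d) ts →
                Any (λ s → Depth s c (suc d)) ts
  depth-edge* (w ∷ _) (here (q , dp)) = here (depth-edge w q dp)
  depth-edge* (_ ∷ ws) (there r) = there (depth-edge* ws r)

chain-depth : ∀ {t a b n d} → Distinct t → Chain (edges t) a b n → Depth t a d → Depth t b (n + d)
chain-depth w stay dp = dp
chain-depth {n = suc n} {d} w (link q r) dp =
  subst (Depth _ _) (ℕₚ.+-suc n d) (chain-depth w r (depth-edge w q dp))

-- ancestry is antisymmetric (a chain cannot return to its start: depth grows)
anc-antisym : ∀ {t a b n m} → Distinct t → Chain (edges t) a b n → Chain (edges t) b a m → a ≡ b
anc-antisym w stay _ = refl
anc-antisym {t} {n = suc n} {m} w r@(link q _) r' =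
  let (d , dp) = depth-exists t (parent∈letters t q)
  in ⊥-elim (ℕₚ.m≢1+n+m d (depth-unique w dp (chain-depth w (chain-++ r r') dp)))

mutual
  unique-parent : ∀ {t p p' c} → Distinct t → (p , c) ∈ edges t → (p' , c) ∈ edges t → p ≡ p'
  unique-parent {node a ts} w q q' with ∈edges⁻ a ts q | ∈edges⁻ a ts q'
  ... | inj₁ r | inj₁ r' = trans (top-edge-parent r) (sym (top-edge-parent r'))
  ... | inj₁ r | inj₂ r' = ⊥-elim (top-edge-not-deeper w r r')
  ... | inj₂ r | inj₁ r' = ⊥-elim (top-edge-not-deeper w r' r)
  ... | inj₂ r | inj₂ r' with w
  ...   | distinct ws _ ap =
    unique-parent* ws (same-child ap (Any.map (λ q → child∈letters _ q , q) r) (Any.map (λ q → child∈letters _ q , q) r'))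

  unique-parent* : ∀ {ts p p' c} → All Distinct ts → Any (λ s → (p , c) ∈ edges s × (p' , c) ∈ edges s) ts → p ≡ p'
  unique-parent* (w ∷ _) (here (q , q')) = unique-parent w q q'
  unique-parent* (_ ∷ ws) (there r) = unique-parent* ws r

  top-edge-not-deeper : ∀ {a ts p p' c} → Distinct (node a ts) → Any (λ s → (p , c) ≡ (a , root s)) ts →
                        Any (λ s → (p' , c) ∈ edges s) ts → ⊥
  top-edge-not-deeper (distinct ws _ ap) r r' =
    All.lookupWith (λ w (e , q) → child≢root _ w q e) ws
      (same-child ap (Any.map (λ e → subst (_∈ letters _) (sym e) (root∈letters _) , e) (top-edge-child r))
                     (Any.map (λ q → child∈letters _ q , q) r'))

edge-by-child : ∀ {t u v} → Distinct t → u ∈ edges t → v ∈ edges t → proj₂ u ≡ proj₂ v → u ≡ v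
edge-by-child w uq vq refl = ×-≡,≡→≡ (unique-parent w uq vq , refl)

module CutAnc {S x S1 S2} (c : Cut S x S1 S2) (w : Distinct S) where
  open CutFacts (cutFacts c) public

  distinct₁ : Distinct S1
  distinct₁ = proj₁ (cut-distinct c w)

  distinct₂ : Distinct S2
  distinct₂ = proj₁ (proj₂ (cut-distinct c w))

  disjoint : DisjointLetters S1 S2
  disjoint = proj₂ (proj₂ (cut-distinct c w))

  child∈₂ : proj₂ x ∈ letters S2
  child∈₂ = subst (_∈ letters S2) (sym root₂) (root∈letters S2)

  cut∉₁ : x ∉ edges S1
  cut∉₁ q = disjoint (child∈letters S1 q) child∈₂

  cut∉₂ : x ∉ edges S2
  cut∉₂ q = disjoint parent∈₁ (parent∈letters S2 q)

  edge₁∉₂ : ∀ {e} → e ∈ edges S1 → e ∉ edges S2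
  edge₁∉₂ q q' = disjoint (parent∈letters S1 q) (parent∈letters S2 q')

  chain₂ : ∀ {a b n} → Chain (edges S) a b n → a ∈ letters S2 → Chain (edges S2) a b n
  chain₂ stay _ = stay
  chain₂ (link q r) p with split q
  ... | inj₁ refl = ⊥-elim (disjoint parent∈₁ p)
  ... | inj₂ (inj₁ q1) = ⊥-elim (disjoint (parent∈letters S1 q1) p)
  ... | inj₂ (inj₂ q2) = link q2 (chain₂ r (child∈letters S2 q2))

  chain₁ : ∀ {a b n} → Chain (edges S) a b n → a ∈ letters S1 → ¬ Anc (edges S) (proj₂ x) b →
           Chain (edges S1) a b n
  chain₁ stay _ _ = stay
  chain₁ (link q r) p nd with split q
  ... | inj₁ refl = ⊥-elim (nd (_ , r))
  ... | inj₂ (inj₁ q1) = link q1 (chain₁ r (child∈letters S1 q1) nd)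
  ... | inj₂ (inj₂ q2) = ⊥-elim (disjoint p (parent∈letters S2 q2))

  anc⇒edge₂ : ∀ {e} → e ∈ edges S → Anc (edges S) (proj₂ x) (proj₁ e) → e ∈ edges S2
  anc⇒edge₂ q (n , r) with split q | chain-end∈ S2 (chain₂ r child∈₂) child∈₂
  ... | inj₁ refl | p = ⊥-elim (disjoint parent∈₁ p)
  ... | inj₂ (inj₁ q1) | p = ⊥-elim (disjoint (parent∈letters S1 q1) p)
  ... | inj₂ (inj₂ q2) | p = q2

  edge₂⇒anc : ∀ {e} → e ∈ edges S2 → Anc (edges S) (proj₂ x) (proj₁ e)
  edge₂⇒anc q = subst (λ z → Anc (edges S) z _) (sym root₂) (anc-mono edge₂ (root-anc S2 (parent∈letters S2 q)))

  non-anc⇒edge₁ : ∀ {e} → e ∈ edges S → e ≢ x → ¬ Anc (edges S) (proj₂ x) (proj₁ e) → e ∈ edges S1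
  non-anc⇒edge₁ q nx nd with split q
  ... | inj₁ e = ⊥-elim (nx e)
  ... | inj₂ (inj₁ q1) = q1
  ... | inj₂ (inj₂ q2) = ⊥-elim (nd (edge₂⇒anc q2))

  edge₁⇒non-anc : ∀ {e} → e ∈ edges S1 → e ≢ x × ¬ Anc (edges S) (proj₂ x) (proj₁ e)
  edge₁⇒non-anc q = (λ { refl → cut∉₁ q }) ,
                    λ { (n , r) → disjoint (parent∈letters S1 q) (chain-end∈ S2 (chain₂ r child∈₂) child∈₂) }

  parent⇒edge₂ : ∀ {e} → e ∈ edges S → proj₁ e ∈ letters S2 → e ∈ edges S2
  parent⇒edge₂ q p with split q
  ... | inj₁ refl = ⊥-elim (disjoint parent∈₁ p)
  ... | inj₂ (inj₁ q1) = ⊥-elim (disjoint (parent∈letters S1 q1) p)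
  ... | inj₂ (inj₂ q2) = q2

  parent⇒edge₁ : ∀ {e} → e ∈ edges S → proj₁ e ∈ letters S1 → e ≢ x → e ∈ edges S1
  parent⇒edge₁ q p nx with split q
  ... | inj₁ e = ⊥-elim (nx e)
  ... | inj₂ (inj₁ q1) = q1
  ... | inj₂ (inj₂ q2) = ⊥-elim (disjoint p (parent∈letters S2 q2))

anc-comparable : ∀ {t a a' b n m} → Distinct t → Chain (edges t) a b n → Chain (edges t) a' b m →
                 Anc (edges t) a a' ⊎ Anc (edges t) a' a
anc-comparable {n = zero} w stay r' = inj₂ (_ , r')
anc-comparable {n = suc n} {m = zero} w r stay = inj₁ (_ , r)
anc-comparable {n = suc n} {m = suc m} w r r' with chain-last r | chain-last r'
... | (q , d , e) | (q' , d' , e') with unique-parent w e e'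
...   | refl = anc-comparable w d d'

anc-via-parent : ∀ {t a c p n} → Distinct t → Chain (edges t) a c n → (p , c) ∈ edges t →
                 a ≡ c ⊎ Anc (edges t) a p
anc-via-parent {n = zero} w stay q = inj₁ refl
anc-via-parent {n = suc n} w r q with chain-last r
... | (q' , d , e) with unique-parent w e q
...   | refl = inj₂ (_ , d)

anc-restrict : ∀ {T S a b m n} → Distinct T → edges S ⊆ edges T → Chain (edges S) a b n →
               Anc (edges T) a m → Anc (edges T) m b → Anc (edges S) m b
anc-restrict {n = zero} wT sub stay (k , r1) (l , r2) with anc-antisym wT r1 r2
... | refl = 0 , stay
anc-restrict {n = suc n} wT sub r d1 (zero , stay) = 0 , stay
anc-restrict {S = S} {n = suc n} wT sub r d1 (suc l , r2) with chain-last r | chain-last r2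
... | (q , dS , eS) | (q' , d2 , e2) with unique-parent wT (sub eS) e2
...   | refl = let (j , d) = anc-restrict {S = S} wT sub dS d1 (l , d2) in suc j , chain-snoc d eS

anc-cycle : ∀ {t u v} → Distinct t → u ∈ edges t → v ∈ edges t →
            Anc (edges t) (proj₂ u) (proj₁ v) → Anc (edges t) (proj₂ v) (proj₁ u) → u ≡ v
anc-cycle w uq vq (n , r) (m , r') =
  edge-by-child w uq vq (anc-antisym w (chain-snoc r vq) (chain-snoc r' uq))

incomparable-edges : ∀ {t u v b} → Distinct t → u ∈ edges t → v ∈ edges t → u ≢ v →
                     ¬ Anc (edges t) (proj₂ u) (proj₁ v) → ¬ Anc (edges t) (proj₂ v) (proj₁ u) →
                     Anc (edges t) (proj₂ u) b → Anc (edges t) (proj₂ v) b → ⊥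
incomparable-edges w uq vq nuv n1 n2 (_ , r1) (_ , r2) with anc-comparable w r1 r2
... | inj₁ (_ , d) with anc-via-parent w d vq
...   | inj₁ e = nuv (edge-by-child w uq vq e)
...   | inj₂ d' = n1 d'
incomparable-edges w uq vq nuv n1 n2 (_ , r1) (_ , r2) | inj₂ (_ , d) with anc-via-parent w d uq
...   | inj₁ e = nuv (edge-by-child w uq vq (sym e))
...   | inj₂ d' = n2 d'

module Positions (V : Set) where
  data Occurs : Cons V → V → Set where
    label : ∀ {Y Ts y} → y ∈ Y → Occurs (node Y Ts) y
    inChild : ∀ {Y Ts y} → Any (λ t → Occurs t y) Ts → Occurs (node Y Ts) y

  data Below : Cons V → V → V → Set where
    top : ∀ {Y Ts x y} → x ∈ Y → Occurs (node Y Ts) y → Below (node Y Ts) x y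
    sub : ∀ {Y Ts x y} → Any (λ t → Below t x y) Ts → Below (node Y Ts) x y

  data SameNode : Cons V → V → V → Set where
    top : ∀ {Y Ts x y} → x ∈ Y → y ∈ Y → SameNode (node Y Ts) x y
    sub : ∀ {Y Ts x y} → Any (λ t → SameNode t x y) Ts → SameNode (node Y Ts) x y

module Constructs {V : Set} (_≟_ : DecidableEquality V) (𝐇 : List V → Set) where
  open Hypergraph _≟_ 𝐇
  open Positions V public
  open DecMem _≟_ using (_∈?_)

  ∖⁻ : ∀ {S Y y} → y ∈ S ∖ Y → y ∈ S × y ∉ Y
  ∖⁻ {S} {Y} p = ∈-filter⁻ (λ x → ¬? (x ∈? Y)) {xs = S} p

  ∖⁺ : ∀ {S Y y} → y ∈ S → y ∉ Y → y ∈ S ∖ Y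
  ∖⁺ {S} {Y} p q = ∈-filter⁺ (λ x → ¬? (x ∈? Y)) {xs = S} p q

  mutual
    below-occurs : ∀ {T x y} → Below T x y → Occurs T y
    below-occurs (top _ i) = i
    below-occurs (sub b) = inChild (below-occurs* b)

    below-occurs* : ∀ {Ts x y} → Any (λ t → Below t x y) Ts → Any (λ t → Occurs t y) Ts
    below-occurs* (here b) = here (below-occurs b)
    below-occurs* (there b) = there (below-occurs* b)

  mutual
    below-occursˡ : ∀ {T x y} → Below T x y → Occurs T x
    below-occursˡ (top xY _) = label xY
    below-occursˡ (sub b) = inChild (below-occursˡ* b)

    below-occursˡ* : ∀ {Ts x y} → Any (λ t → Below t x y) Ts → Any (λ t → Occurs t x) Ts
    below-occursˡ* (here b) = here (below-occursˡ b)
    below-occursˡ* (there b) = there (below-occursˡ* b)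

  component⊆ : ∀ {X : List V} {Cs : List (List V)} {y : V} →
               All (λ C → NonEmpty C × C ⊆ X × Connected C) Cs → Any (y ∈_) Cs → y ∈ X
  component⊆ ((_ , s , _) ∷ _) (here p) = s p
  component⊆ (_ ∷ a) (there p) = component⊆ a p

  disjoint-components : ∀ {C : List V} {Cs : List (List V)} {x : V} →
                        All (Disjoint C) Cs → x ∈ C → Any (x ∈_) Cs → ⊥
  disjoint-components d xC p = All.lookupWith (λ d q → d xC q) d p

  mutual
    occurs⇒∈ : ∀ {S T y} → IsConstruct S T → Occurs T y → y ∈ S
    occurs⇒∈ (construct Cs _ Y⊆ _ _) (label p) = Y⊆ p
    occurs⇒∈ (construct Cs _ _ (ac , _) pw) (inChild p) = proj₁ (∖⁻ (component⊆ ac (occurs⇒∈* pw p)))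

    occurs⇒∈* : ∀ {Cs Ts y} → Pointwise IsConstruct Cs Ts → Any (λ t → Occurs t y) Ts → Any (y ∈_) Cs
    occurs⇒∈* (c ∷ _) (here p) = here (occurs⇒∈ c p)
    occurs⇒∈* (_ ∷ pw) (there p) = there (occurs⇒∈* pw p)

  mutual
    ∈⇒occurs : ∀ {S T y} → IsConstruct S T → y ∈ S → Occurs T y
    ∈⇒occurs {y = y} (construct {Y = Y} Cs _ _ (_ , _ , cov , _) pw) p with y ∈? Y
    ... | yes q = label q
    ... | no q = inChild (∈⇒occurs* pw (cov (∖⁺ p q)))

    ∈⇒occurs* : ∀ {Cs Ts y} → Pointwise IsConstruct Cs Ts → Any (y ∈_) Cs → Any (λ t → Occurs t y) Ts
    ∈⇒occurs* (c ∷ _) (here p) = here (∈⇒occurs c p)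
    ∈⇒occurs* (_ ∷ pw) (there p) = there (∈⇒occurs* pw p)

  child∉root : ∀ {S Y Ts y} → IsConstruct S (node Y Ts) → Any (λ t → Occurs t y) Ts → y ∉ Y
  child∉root {S} (construct Cs _ _ (ac , _) pw) p = proj₂ (∖⁻ {S} (component⊆ ac (occurs⇒∈* pw p)))

  mutual
    below-refl : ∀ {S T x} → IsConstruct S T → x ∈ S → Below T x x
    below-refl {x = x} (construct {Y = Y} Cs _ _ (_ , _ , cov , _) pw) p with x ∈? Y
    ... | yes q = top q (label q)
    ... | no q = sub (below-refl* pw (cov (∖⁺ p q)))

    below-refl* : ∀ {Cs Ts x} → Pointwise IsConstruct Cs Ts → Any (x ∈_) Cs → Any (λ t → Below t x x) Ts
    below-refl* (c ∷ _) (here p) = here (below-refl c p)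
    below-refl* (_ ∷ pw) (there p) = there (below-refl* pw p)

  mutual
    below-antisym : ∀ {S T x y} → IsConstruct S T → Below T x y → Below T y x → SameNode T x y
    below-antisym c (top xY _) (top yY _) = top xY yY
    below-antisym c (top xY _) (sub b) = ⊥-elim (child∉root c (below-occurs* b) xY)
    below-antisym c (sub b) (top yY _) = ⊥-elim (child∉root c (below-occurs* b) yY)
    below-antisym (construct Cs _ _ (_ , ap , _) pw) (sub b1) (sub b2) = sub (below-antisym* pw ap b1 b2)

    below-antisym* : ∀ {Cs Ts x y} → Pointwise IsConstruct Cs Ts → AllPairs Disjoint Cs →
                     Any (λ t → Below t x y) Ts → Any (λ t → Below t y x) Ts → Any (λ t → SameNode t x y) Ts
    below-antisym* (c ∷ _) (_ ∷ _) (here b1) (here b2) = here (below-antisym c b1 b2)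
    below-antisym* (c ∷ pw) (a ∷ _) (here b1) (there b2) =
      ⊥-elim (disjoint-components a (occurs⇒∈ c (below-occursˡ b1)) (occurs⇒∈* pw (below-occurs* b2)))
    below-antisym* (c ∷ pw) (a ∷ _) (there b1) (here b2) =
      ⊥-elim (disjoint-components a (occurs⇒∈ c (below-occurs b2)) (occurs⇒∈* pw (below-occursˡ* b1)))
    below-antisym* (_ ∷ pw) (_ ∷ ap) (there b1) (there b2) = there (below-antisym* pw ap b1 b2)

  mutual
    below-trans : ∀ {S T x y z} → IsConstruct S T → Below T y x → Below T x z → Below T y z
    below-trans c (top yY _) b = top yY (below-occurs b)
    below-trans c (sub b) (top xY _) = ⊥-elim (child∉root c (below-occurs* b) xY)
    below-trans (construct Cs _ _ (_ , ap , _) pw) (sub b1) (sub b2) = sub (below-trans* pw ap b1 b2)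

    below-trans* : ∀ {Cs Ts x y z} → Pointwise IsConstruct Cs Ts → AllPairs Disjoint Cs →
                   Any (λ t → Below t y x) Ts → Any (λ t → Below t x z) Ts → Any (λ t → Below t y z) Ts
    below-trans* (c ∷ _) (_ ∷ _) (here b1) (here b2) = here (below-trans c b1 b2)
    below-trans* (c ∷ pw) (a ∷ _) (here b1) (there b2) =
      ⊥-elim (disjoint-components a (occurs⇒∈ c (below-occurs b1)) (occurs⇒∈* pw (below-occursˡ* b2)))
    below-trans* (c ∷ pw) (a ∷ _) (there b1) (here b2) =
      ⊥-elim (disjoint-components a (occurs⇒∈ c (below-occursˡ b2)) (occurs⇒∈* pw (below-occurs* b1)))
    below-trans* (_ ∷ pw) (_ ∷ ap) (there b1) (there b2) = there (below-trans* pw ap b1 b2)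

  connected-≐ : ∀ {C K} → C ⊆ K → K ⊆ C → Connected K → Connected C
  connected-≐ CK KC cK (X₁ , X₂ , n1 , n2 , d , s1 , s2 , cov , h) =
    cK (X₁ , X₂ , n1 , n2 , d , (λ p → CK (s1 p)) , (λ p → CK (s2 p)) , (λ p → cov (KC p)) ,
        λ Z hZ ZK → h Z hZ (λ p → KC (ZK p)))

  -- Downset S T x: the set C of vertices below x in the construct T of 𝐇_S;
  -- C is connected, or C is all of S (when x is in the root label).
  record Downset (S : List V) (T : Cons V) (x : V) : Set where
    field
      C : List V
      conn : Connected C ⊎ S ⊆ C
      C⊆ : C ⊆ S
      x∈ : x ∈ C
      fwd : ∀ {z} → z ∈ C → Below T x z
      bwd : ∀ {z} → Below T x z → z ∈ C

  record DownsetL (S : List V) (Ts : List (Cons V)) (x : V) : Set where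
    field
      C : List V
      conn : Connected C
      C⊆ : C ⊆ S
      x∈ : x ∈ C
      fwd : ∀ {z} → z ∈ C → Any (λ t → Below t x z) Ts
      bwd : ∀ {z} → Any (λ t → Below t x z) Ts → z ∈ C

  connected-of : ∀ {C K S} → Connected C ⊎ S ⊆ C → C ⊆ K → Connected K → K ⊆ S → Connected C
  connected-of (inj₁ c) _ _ _ = c
  connected-of (inj₂ SC) CK cK KS = connected-≐ CK (λ p → SC (KS p)) cK

  mutual
    downset : ∀ {S T x} → IsConstruct S T → x ∈ S → Downset S T x
    downset {S} {x = x} c@(construct {Y = Y} Cs _ _ (ac , ap , cov , _) pw) p with x ∈? Y
    ... | yes q = record { C = S ; conn = inj₂ (λ z → z) ; C⊆ = λ z → z ; x∈ = p
                         ; fwd = λ z → top q (∈⇒occurs c z) ; bwd = λ b → occurs⇒∈ c (below-occurs b) }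
    ... | no q = let r = downset* pw ap ac (cov (∖⁺ p q)) in
      record { C = DownsetL.C r ; conn = inj₁ (DownsetL.conn r) ; C⊆ = λ z → proj₁ (∖⁻ (DownsetL.C⊆ r z))
             ; x∈ = DownsetL.x∈ r ; fwd = λ z → sub (DownsetL.fwd r z)
             ; bwd = λ { (top xY _) → ⊥-elim (q xY) ; (sub b) → DownsetL.bwd r b } }

    downset* : ∀ {X Cs Ts x} → Pointwise IsConstruct Cs Ts → AllPairs Disjoint Cs →
               All (λ C → NonEmpty C × C ⊆ X × Connected C) Cs → Any (x ∈_) Cs → DownsetL X Ts x
    downset* (c ∷ pw) (a ∷ ap) ((_ , K⊆ , cK) ∷ ac) (here p) =
      let r = downset c p in
      record { C = Downset.C r
             ; conn = connected-of (Downset.conn r) (Downset.C⊆ r) cK (λ p → p)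
             ; C⊆ = λ z → K⊆ (Downset.C⊆ r z) ; x∈ = Downset.x∈ r ; fwd = λ z → here (Downset.fwd r z)
             ; bwd = λ { (here b) → Downset.bwd r b
                       ; (there b) → ⊥-elim (disjoint-components a p (occurs⇒∈* pw (below-occursˡ* b))) } }
    downset* (c ∷ pw) (a ∷ ap) (_ ∷ ac) (there p) =
      let r = downset* pw ap ac p in
      record { C = DownsetL.C r ; conn = DownsetL.conn r ; C⊆ = DownsetL.C⊆ r ; x∈ = DownsetL.x∈ r
             ; fwd = λ z → there (DownsetL.fwd r z)
             ; bwd = λ { (here b) → ⊥-elim (disjoint-components a (occurs⇒∈ c (below-occursˡ b)) p)
                       ; (there b) → DownsetL.bwd r b } }

  same-component : ∀ {Cs z} {P Q : List V → Set} → AllPairs Disjoint Cs →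
                   Any (λ K → z ∈ K × P K) Cs → Any (λ K → z ∈ K × Q K) Cs → Any (λ K → P K × Q K) Cs
  same-component (_ ∷ _) (here (_ , p)) (here (_ , q)) = here (p , q)
  same-component (a ∷ _) (here (z1 , _)) (there b) = ⊥-elim (disjoint-components a z1 (Any.map proj₁ b))
  same-component (a ∷ _) (there b) (here (z1 , _)) = ⊥-elim (disjoint-components a z1 (Any.map proj₁ b))
  same-component (_ ∷ ap) (there b1) (there b2) = there (same-component ap b1 b2)

  -- a connected set C ⊆ X lies inside a single component of 𝐇_X: otherwise
  -- "lies in the component of x" splits C into two non-empty parts that no
  -- hyperedge crosses
  connected-in-component : ∀ {X Cs C x} → AllPairs Disjoint Cs → (∀ {x} → x ∈ X → Any (x ∈_) Cs) →
                           (∀ Z → 𝐇 Z → Z ⊆ X → Any (Z ⊆_) Cs) → Connected C → C ⊆ X → x ∈ C →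
                           ∀ {z} → z ∈ C → Any (λ K → x ∈ K × z ∈ K) Cs
  connected-in-component {X} {Cs} {C} {x} ap cov hyp cC CX xC {z} zC
    with any? (λ K → (x ∈? K) ×-dec (z ∈? K)) Cs
  ... | yes r = r
  ... | no nr = ⊥-elim (cC (X₁ , X₂ , (x , x∈X₁) , (z , ∈-filter⁺ (λ w → ¬? (InK? w)) zC nr) ,
                          (λ p q → proj₂ (∈-filter⁻ (λ w → ¬? (InK? w)) {xs = C} q) (proj₂ (∈-filter⁻ InK? {xs = C} p))) ,
                          (λ p → proj₁ (∈-filter⁻ InK? {xs = C} p)) ,
                          (λ p → proj₁ (∈-filter⁻ (λ w → ¬? (InK? w)) {xs = C} p)) ,
                          cover , hedge))
    where
      InK : V → Set
      InK w = Any (λ K → x ∈ K × w ∈ K) Cs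
      InK? : ∀ w → Dec (InK w)
      InK? w = any? (λ K → (x ∈? K) ×-dec (w ∈? K)) Cs
      X₁ = filter InK? C
      X₂ = filter (λ w → ¬? (InK? w)) C
      x∈X₁ : x ∈ X₁
      x∈X₁ = ∈-filter⁺ InK? xC (Any.map (λ p → p , p) (cov (CX xC)))
      cover : ∀ {w} → w ∈ C → w ∈ X₁ ⊎ w ∈ X₂
      cover {w} p with InK? w
      ... | yes q = inj₁ (∈-filter⁺ InK? p q)
      ... | no q = inj₂ (∈-filter⁺ (λ w → ¬? (InK? w)) p q)
      hedge : ∀ Z → 𝐇 Z → Z ⊆ C → Z ⊆ X₁ ⊎ Z ⊆ X₂
      hedge Z hZ ZC with any? InK? Z
      ... | yes a = let (z0 , z0Z , kz0) = find a
                        g = same-component ap (Any.map (λ { (p , q) → q , p }) kz0)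
                                          (Any.map (λ ZK → ZK z0Z , ZK) (hyp Z hZ (λ p → CX (ZC p))))
                    in inj₁ (λ {w} wZ → ∈-filter⁺ InK? (ZC wZ) (Any.map (λ { (p , ZK) → p , ZK wZ }) g))
      ... | no na = inj₂ (λ {w} wZ → ∈-filter⁺ (λ w → ¬? (InK? w)) (ZC wZ) (λ k → na (lose wZ k)))

  minimal-avoids-root : ∀ {S Y Ts x} {C : List V} → IsConstruct S (node Y Ts) → x ∉ Y → C ⊆ S → x ∈ C →
                        (∀ {y} → y ∈ C → Below (node Y Ts) y x → Below (node Y Ts) x y) →
                        ∀ {y} → y ∈ C → y ∉ Y
  minimal-avoids-root c x∉Y CS xC h yC yY with h yC (top yY (∈⇒occurs c (CS xC)))
  ... | top xY _ = x∉Y xY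
  ... | sub b = child∉root c (below-occurs* b) yY

  mutual
    below-lower-bound : ∀ {S T x} → IsConstruct S T → (C : List V) → Connected C ⊎ S ⊆ C → C ⊆ S → x ∈ C →
                        (∀ {y} → y ∈ C → Below T y x → Below T x y) → ∀ {z} → z ∈ C → Below T x z
    below-lower-bound {x = x} c@(construct {Y = Y} Cs (y0 , y0Y) Y⊆ (ac , ap , cov , hyp) pw) C conn CS xC h zC
      with x ∈? Y
    ... | yes q = top q (∈⇒occurs c (CS zC))
    ... | no q with conn
    ...   | inj₂ SC = ⊥-elim (minimal-avoids-root c q CS xC h (SC (Y⊆ y0Y)) y0Y)
    ...   | inj₁ cC = sub (below-lower-bound* pw ap (cov (∖⁺ (CS xC) q)) C cC xC
                            (connected-in-component ap cov hyp cC CSY xC) h-child zC)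
      where
        CSY : C ⊆ _
        CSY yC = ∖⁺ (CS yC) (minimal-avoids-root c q CS xC h yC)
        h-child : ∀ {y} → y ∈ C → Any (λ t → Below t y x) _ → Any (λ t → Below t x y) _
        h-child yC b with h yC (sub b)
        ... | top xY _ = ⊥-elim (q xY)
        ... | sub b' = b'

    below-lower-bound* : ∀ {Cs Ts x} → Pointwise IsConstruct Cs Ts → AllPairs Disjoint Cs → Any (x ∈_) Cs →
                         (C : List V) → Connected C → x ∈ C → (∀ {z} → z ∈ C → Any (λ K → x ∈ K × z ∈ K) Cs) →
                         (∀ {y} → y ∈ C → Any (λ t → Below t y x) Ts → Any (λ t → Below t x y) Ts) →
                         ∀ {z} → z ∈ C → Any (λ t → Below t x z) Ts
    below-lower-bound* (c ∷ pw) (a ∷ ap) (here xK) C cC xC ik h zC =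
      here (below-lower-bound c C (inj₁ cC) CK xC h' zC)
      where
        CK : C ⊆ _
        CK yC with ik yC
        ... | here (_ , p) = p
        ... | there p = ⊥-elim (disjoint-components a xK (Any.map proj₁ p))
        h' : ∀ {y} → y ∈ C → Below _ y _ → Below _ _ y
        h' yC b with h yC (here b)
        ... | here b' = b'
        ... | there b' = ⊥-elim (disjoint-components a xK (occurs⇒∈* pw (below-occursˡ* b')))
    below-lower-bound* (c ∷ pw) (a ∷ ap) (there xK) C cC xC ik h zC =
      there (below-lower-bound* pw ap xK C cC xC ik' h' zC)
      where
        ik' : ∀ {z} → z ∈ C → Any _ _
        ik' yC with ik yC
        ... | here (xK0 , _) = ⊥-elim (disjoint-components a xK0 xK)
        ... | there p = p
        h' : ∀ {y} → y ∈ C → Any _ _ → Any _ _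
        h' yC b with h yC (there b)
        ... | here b' = ⊥-elim (disjoint-components a (occurs⇒∈ c (below-occursˡ b')) xK)
        ... | there b' = b'

  mutual
    occurs-≈ : ∀ {T T' y} → T ≈ T' → Occurs T y → Occurs T' y
    occurs-≈ (node Y≐ _) (label p) = label (proj₁ Y≐ p)
    occurs-≈ (node _ ps) (inChild p) = inChild (occurs-≈* ps p)

    occurs-≈* : ∀ {Ts Ts' y} → Ts ≈* Ts' → Any (λ t → Occurs t y) Ts → Any (λ t → Occurs t y) Ts'
    occurs-≈* (_∷_ {As = As} p ps) (here i) = any-at As (occurs-≈ p i)
    occurs-≈* (_∷_ {As = As} p ps) (there i) = any-insert As (occurs-≈* ps i)

  mutual
    occurs-≈⁻ : ∀ {T T' y} → T ≈ T' → Occurs T' y → Occurs T y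
    occurs-≈⁻ (node Y≐ _) (label p) = label (proj₂ Y≐ p)
    occurs-≈⁻ (node _ ps) (inChild p) = inChild (occurs-≈⁻* ps p)

    occurs-≈⁻* : ∀ {Ts Ts' y} → Ts ≈* Ts' → Any (λ t → Occurs t y) Ts' → Any (λ t → Occurs t y) Ts
    occurs-≈⁻* (_∷_ {As = As} p ps) a with any-split As a
    ... | inj₁ q = there (occurs-≈⁻* ps (AnyP.++⁺ˡ q))
    ... | inj₂ (inj₁ i) = here (occurs-≈⁻ p i)
    ... | inj₂ (inj₂ q) = there (occurs-≈⁻* ps (AnyP.++⁺ʳ As q))

  mutual
    below-≈ : ∀ {T T' x y} → T ≈ T' → Below T x y → Below T' x y
    below-≈ e@(node Y≐ _) (top p i) = top (proj₁ Y≐ p) (occurs-≈ e i)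
    below-≈ (node _ ps) (sub p) = sub (below-≈* ps p)

    below-≈* : ∀ {Ts Ts' x y} → Ts ≈* Ts' → Any (λ t → Below t x y) Ts → Any (λ t → Below t x y) Ts'
    below-≈* (_∷_ {As = As} p ps) (here i) = any-at As (below-≈ p i)
    below-≈* (_∷_ {As = As} p ps) (there i) = any-insert As (below-≈* ps i)

  mutual
    below-≈⁻ : ∀ {T T' x y} → T ≈ T' → Below T' x y → Below T x y
    below-≈⁻ e@(node Y≐ _) (top p i) = top (proj₂ Y≐ p) (occurs-≈⁻ e i)
    below-≈⁻ (node _ ps) (sub p) = sub (below-≈⁻* ps p)

    below-≈⁻* : ∀ {Ts Ts' x y} → Ts ≈* Ts' → Any (λ t → Below t x y) Ts' → Any (λ t → Below t x y) Ts
    below-≈⁻* (_∷_ {As = As} p ps) a with any-split As a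
    ... | inj₁ q = there (below-≈⁻* ps (AnyP.++⁺ˡ q))
    ... | inj₂ (inj₁ i) = here (below-≈⁻ p i)
    ... | inj₂ (inj₂ q) = there (below-≈⁻* ps (AnyP.++⁺ʳ As q))

  ≐-trans : ∀ {A B C : List V} → A ≐ B → B ≐ C → A ≐ C
  ≐-trans (f , g) (h , k) = (λ p → h (f p)) , (λ p → g (k p))

  mutual
    parentOf-≈⁻ : ∀ {T T' a b} → T ≈ T' → ParentOf a b T' → ParentOf a b T
    parentOf-≈⁻ (node Y≐ ps) (here Y'≐ r) = here (≐-trans Y≐ Y'≐) (root-child-≈⁻ ps r)
    parentOf-≈⁻ (node _ ps) (there p) = there (parentOf-≈⁻* ps p)

    parentOf-≈⁻* : ∀ {Ts Ts' a b} → Ts ≈* Ts' → Any (ParentOf a b) Ts' → Any (ParentOf a b) Ts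
    parentOf-≈⁻* (_∷_ {As = As} p ps) a with any-split As a
    ... | inj₁ q = there (parentOf-≈⁻* ps (AnyP.++⁺ˡ q))
    ... | inj₂ (inj₁ i) = here (parentOf-≈⁻ p i)
    ... | inj₂ (inj₂ q) = there (parentOf-≈⁻* ps (AnyP.++⁺ʳ As q))

    root-child-≈⁻ : ∀ {Ts Ts' b} → Ts ≈* Ts' → Any (λ C → rootLabel C ≐ [ b ]) Ts' →
                    Any (λ C → rootLabel C ≐ [ b ]) Ts
    root-child-≈⁻ (_∷_ {As = As} p@(node Y≐ _) ps) a with any-split As a
    ... | inj₁ q = there (root-child-≈⁻ ps (AnyP.++⁺ˡ q))
    ... | inj₂ (inj₁ i) = here (≐-trans Y≐ i)
    ... | inj₂ (inj₂ q) = there (root-child-≈⁻ ps (AnyP.++⁺ʳ As q))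

  -- Occurs and Below are monotone along the order ≤ on constructs: merging a
  -- child into its parent only moves vertices up.
  occurs-mono : ∀ {S T T' y} → S ⊢ T ≤ T' → Occurs T y → Occurs T' y
  occurs-mono (≤-refl _ e) i = occurs-≈ e i
  occurs-mono (≤-trans p q) i = occurs-mono q (occurs-mono p i)
  occurs-mono (≤-merge _ _ _ _ _ _ _ _) (label p) = label (∈-++⁺ˡ p)
  occurs-mono (≤-merge {Y = Y} _ _ _ _ _ _ _ _) (inChild (here (label p))) = label (∈-++⁺ʳ Y p)
  occurs-mono (≤-merge _ _ _ _ _ _ _ _) (inChild (here (inChild q))) = inChild (AnyP.++⁺ˡ q)
  occurs-mono (≤-merge {T₁s = T₁s} _ _ _ _ _ _ _ _) (inChild (there q)) = inChild (AnyP.++⁺ʳ T₁s q)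
  occurs-mono (≤-cong _ _ _ p _) (label q) = label q
  occurs-mono (≤-cong _ _ _ p _) (inChild (here q)) = inChild (here (occurs-mono p q))
  occurs-mono (≤-cong _ _ _ p _) (inChild (there q)) = inChild (there q)

  below-mono : ∀ {S T T' x y} → S ⊢ T ≤ T' → Below T x y → Below T' x y
  below-mono (≤-refl _ e) i = below-≈ e i
  below-mono (≤-trans p q) i = below-mono q (below-mono p i)
  below-mono m@(≤-merge _ _ _ _ _ _ _ _) (top p i) = top (∈-++⁺ˡ p) (occurs-mono m i)
  below-mono m@(≤-merge {Y = Y} _ _ _ _ _ _ _ _) (sub (here (top p i))) =
    top (∈-++⁺ʳ Y p) (occurs-mono m (inChild (here i)))
  below-mono (≤-merge _ _ _ _ _ _ _ _) (sub (here (sub q))) = sub (AnyP.++⁺ˡ q)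
  below-mono (≤-merge {T₁s = T₁s} _ _ _ _ _ _ _ _) (sub (there q)) = sub (AnyP.++⁺ʳ T₁s q)
  below-mono m@(≤-cong _ _ _ p _) (top q i) = top q (occurs-mono m i)
  below-mono (≤-cong _ _ _ p _) (sub (here q)) = sub (here (below-mono p q))
  below-mono (≤-cong _ _ _ p _) (sub (there q)) = sub (there q)

  singleton-label : ∀ {Y : List V} {x y} → Singleton Y → x ∈ Y → y ∈ Y → x ≡ y
  singleton-label (w , Y≐) p q = trans (AnyP.singleton⁻ (proj₁ Y≐ p)) (sym (AnyP.singleton⁻ (proj₁ Y≐ q)))

  mutual
    singleton-sameNode : ∀ {T x y} → AllSingleton T → SameNode T x y → x ≡ y
    singleton-sameNode (node sY _) (top p q) = singleton-label sY p q
    singleton-sameNode (node _ a) (sub s) = singleton-sameNode* a s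

    singleton-sameNode* : ∀ {Ts x y} → All AllSingleton Ts → Any (λ t → SameNode t x y) Ts → x ≡ y
    singleton-sameNode* (a ∷ _) (here s) = singleton-sameNode a s
    singleton-sameNode* (_ ∷ as) (there s) = singleton-sameNode* as s

  doubleton-sameNode : ∀ {u v T x y} → OneDoubleton u v T → SameNode T x y →
                       x ≡ y ⊎ (x ∈ (u ∷ v ∷ []) × y ∈ (u ∷ v ∷ []))
  doubleton-sameNode (here Y≐ _) (top p q) = inj₂ (proj₁ Y≐ p , proj₁ Y≐ q)
  doubleton-sameNode (here _ a) (sub s) = inj₁ (singleton-sameNode* a s)
  doubleton-sameNode (there sY _ _ _) (top p q) = inj₁ (singleton-label sY p q)
  doubleton-sameNode (there {As = As} _ aA od aB) (sub s) with any-split As s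
  ... | inj₁ q = inj₁ (singleton-sameNode* aA q)
  ... | inj₂ (inj₁ q) = doubleton-sameNode od q
  ... | inj₂ (inj₂ q) = inj₁ (singleton-sameNode* aB q)

  doubleton-uv : ∀ {u v T} → OneDoubleton u v T → SameNode T u v
  doubleton-uv (here Y≐ _) = top (proj₂ Y≐ (here refl)) (proj₂ Y≐ (there (here refl)))
  doubleton-uv (there {As = As} _ _ od _) = sub (any-at As (doubleton-uv od))

  doubleton-sym : ∀ {u v T} → OneDoubleton u v T → OneDoubleton v u T
  doubleton-sym (here Y≐ a) = here (≐-trans Y≐ (swap , swap)) a
    where
      swap : ∀ {a b : V} {x} → x ∈ (a ∷ b ∷ []) → x ∈ (b ∷ a ∷ [])
      swap (here e) = there (here e)
      swap (there (here e)) = here e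
  doubleton-sym (there s aA od aB) = there s aA (doubleton-sym od) aB

  mutual
    sameNode⇒below : ∀ {T x y} → SameNode T x y → Below T x y
    sameNode⇒below (top p q) = top p (label q)
    sameNode⇒below (sub s) = sub (sameNode⇒below* s)

    sameNode⇒below* : ∀ {Ts x y} → Any (λ t → SameNode t x y) Ts → Any (λ t → Below t x y) Ts
    sameNode⇒below* (here s) = here (sameNode⇒below s)
    sameNode⇒below* (there s) = there (sameNode⇒below* s)

  mutual
    parent⇒below : ∀ {T a b} → ParentOf a b T → Below T a b
    parent⇒below (here Y≐ r) = top (proj₂ Y≐ (here refl)) (inChild (Any.map root-occurs r))
      where
        root-occurs : ∀ {b C} → rootLabel C ≐ [ b ] → Occurs C b
        root-occurs {C = node Y _} r = label (proj₂ r (here refl))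
    parent⇒below (there p) = sub (parent⇒below* p)

    parent⇒below* : ∀ {Ts a b} → Any (ParentOf a b) Ts → Any (λ t → Below t a b) Ts
    parent⇒below* (here p) = here (parent⇒below p)
    parent⇒below* (there p) = there (parent⇒below* p)

  below-u⇒below-v : ∀ {S E u v z} → IsConstruct S E → OneDoubleton u v E → Below E u z → Below E v z
  below-u⇒below-v cE od b = below-trans cE (sameNode⇒below (doubleton-uv (doubleton-sym od))) b

  -- By the lower-bound lemma applied to the downset of x in E, it suffices that
  -- x is minimal in that downset for W; a y with x below y in W and y below x in
  -- E shares a label with x in E, so y = x unless {x, y} = {u, v}.
  module Reflect {S E W u v} (cE : IsConstruct S E) (od : OneDoubleton u v E)
                 (cW : IsConstruct S W) (le : S ⊢ W ≤ E) (v-not-above-u : ¬ Below W v u) where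

    below-reflect : ∀ {x z} → (∀ {y} → SameNode E x y → Below W y x → y ≡ x) → Below E x z → Below W x z
    below-reflect {x} h b =
      let xS = occurs⇒∈ cE (below-occursˡ b)
          open Downset (downset cE xS)
      in below-lower-bound cW C conn C⊆ x∈
           (λ {y} yC bW → let e = h (below-antisym cE (fwd yC) (below-mono le bW)) bW
                          in subst (Below W x) (sym e) (below-refl cW xS))
           (bwd b)

    reflect-other : ∀ {x z} → x ≢ u → x ≢ v → Below E x z → Below W x z
    reflect-other xu xv = below-reflect λ s bW → case doubleton-sameNode od s of λ
      { (inj₁ e) → sym e
      ; (inj₂ (here e , _)) → ⊥-elim (xu e)
      ; (inj₂ (there (here e) , _)) → ⊥-elim (xv e) }

    reflect-u : ∀ {z} → Below E u z → Below W u z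
    reflect-u = below-reflect λ s bW → case doubleton-sameNode od s of λ
      { (inj₁ e) → sym e
      ; (inj₂ (_ , here e)) → e
      ; (inj₂ (_ , there (here e))) → ⊥-elim (v-not-above-u (subst (λ y → Below W y u) e bW)) }

open Positions TEdge using (Occurs; label; inChild; Below; top; sub)

-- Grafted a x y: in the admissible derivation a, the grafting edge x is at or
-- above the edge y, i.e. y is an edge of the tree S being cut at x.  Under Φ
-- this is exactly Below (see Φ-below⇒grafted and grafted⇒Φ-below).
data Grafted : ∀ {w S} → Admissible w S → TEdge → TEdge → Set where
  top : ∀ {S x S1 S2 w1 w2 y} {c : Cut S x S1 S2} {a1 : Admissible w1 S1} {a2 : Admissible w2 S2} →
        y ∈ edges S → Grafted (graft c a1 a2) x y
  onLeft : ∀ {S x S1 S2 w1 w2 x₀ y} {c : Cut S x S1 S2} {a1 : Admissible w1 S1} {a2 : Admissible w2 S2} →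
           Grafted a1 x₀ y → Grafted (graft c a1 a2) x₀ y
  onRight : ∀ {S x S1 S2 w1 w2 x₀ y} {c : Cut S x S1 S2} {a1 : Admissible w1 S1} {a2 : Admissible w2 S2} →
            Grafted a2 x₀ y → Grafted (graft c a1 a2) x₀ y

grafted∈ : ∀ {w S x y} {a : Admissible w S} → Grafted a x y → x ∈ edges S × y ∈ edges S
grafted∈ (top {c = c} q) = CutFacts.cut∈ (cutFacts c) , q
grafted∈ (onLeft {c = c} b) = let (p , q) = grafted∈ b in CutFacts.edge₁ (cutFacts c) p , CutFacts.edge₁ (cutFacts c) q
grafted∈ (onRight {c = c} b) = let (p , q) = grafted∈ b in CutFacts.edge₂ (cutFacts c) p , CutFacts.edge₂ (cutFacts c) q

mutual
  Φs-occurs⇒∈ : ∀ {w S y} (a : Admissible w S) → Any (λ t → Occurs t y) (Φs a) → y ∈ edges S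
  Φs-occurs⇒∈ (graft c a1 a2) (here i) = Φ-occurs⇒∈ (graft c a1 a2) i

  Φ-occurs⇒∈ : ∀ {w1 w2 S y} (a : Admissible (w1 · w2) S) → Occurs (Φ a) y → y ∈ edges S
  Φ-occurs⇒∈ (graft c a1 a2) (label (here refl)) = CutFacts.cut∈ (cutFacts c)
  Φ-occurs⇒∈ (graft c a1 a2) (inChild p) with AnyP.++⁻ (Φs a1) p
  ... | inj₁ q = CutFacts.edge₁ (cutFacts c) (Φs-occurs⇒∈ a1 q)
  ... | inj₂ q = CutFacts.edge₂ (cutFacts c) (Φs-occurs⇒∈ a2 q)

mutual
  ∈⇒Φs-occurs : ∀ {w S y} (a : Admissible w S) → y ∈ edges S → Any (λ t → Occurs t y) (Φs a)
  ∈⇒Φs-occurs ltr ()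
  ∈⇒Φs-occurs (graft c a1 a2) q = here (∈⇒Φ-occurs (graft c a1 a2) q)

  ∈⇒Φ-occurs : ∀ {w1 w2 S y} (a : Admissible (w1 · w2) S) → y ∈ edges S → Occurs (Φ a) y
  ∈⇒Φ-occurs (graft c a1 a2) q with CutFacts.split (cutFacts c) q
  ... | inj₁ refl = label (here refl)
  ... | inj₂ (inj₁ q1) = inChild (AnyP.++⁺ˡ (∈⇒Φs-occurs a1 q1))
  ... | inj₂ (inj₂ q2) = inChild (AnyP.++⁺ʳ (Φs a1) (∈⇒Φs-occurs a2 q2))

mutual
  Φs-below⇒grafted : ∀ {w S x y} (a : Admissible w S) → Any (λ t → Below t x y) (Φs a) → Grafted a x y
  Φs-below⇒grafted (graft c a1 a2) (here b) = Φ-below⇒grafted (graft c a1 a2) b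

  Φ-below⇒grafted : ∀ {w1 w2 S x y} (a : Admissible (w1 · w2) S) → Below (Φ a) x y → Grafted a x y
  Φ-below⇒grafted a@(graft c a1 a2) (top (here refl) i) = top (Φ-occurs⇒∈ a i)
  Φ-below⇒grafted (graft c a1 a2) (sub p) with AnyP.++⁻ (Φs a1) p
  ... | inj₁ q = onLeft (Φs-below⇒grafted a1 q)
  ... | inj₂ q = onRight (Φs-below⇒grafted a2 q)

mutual
  grafted⇒Φs-below : ∀ {w S x y} (a : Admissible w S) → Grafted a x y → Any (λ t → Below t x y) (Φs a)
  grafted⇒Φs-below (graft c a1 a2) b = here (grafted⇒Φ-below (graft c a1 a2) b)

  grafted⇒Φ-below : ∀ {w1 w2 S x y} (a : Admissible (w1 · w2) S) → Grafted a x y → Below (Φ a) x y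
  grafted⇒Φ-below a@(graft c a1 a2) (top q) = top (here refl) (∈⇒Φ-occurs a q)
  grafted⇒Φ-below (graft c a1 a2) (onLeft b) = sub (AnyP.++⁺ˡ (grafted⇒Φs-below a1 b))
  grafted⇒Φ-below (graft c a1 a2) (onRight b) = sub (AnyP.++⁺ʳ (Φs a1) (grafted⇒Φs-below a2 b))

RootEdge : ∀ {w S} → Admissible w S → TEdge → Set
RootEdge ltr y = ⊥
RootEdge (graft {x = x} _ _ _) y = x ≡ y

rootEdge∈ : ∀ {w S y} (a : Admissible w S) → RootEdge a y → y ∈ edges S
rootEdge∈ (graft c _ _) refl = CutFacts.cut∈ (cutFacts c)

-- ParentPos u v a: somewhere in a, u is grafted with v grafted in one of its
-- two immediate subderivations; this is ParentOf u v read through Φ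
data ParentPos (u v : TEdge) : ∀ {w S} → Admissible w S → Set where
  here : ∀ {S S1 S2 w1 w2} {c : Cut S u S1 S2} {a1 : Admissible w1 S1} {a2 : Admissible w2 S2} →
         RootEdge a1 v ⊎ RootEdge a2 v → ParentPos u v (graft c a1 a2)
  inl : ∀ {S x S1 S2 w1 w2} {c : Cut S x S1 S2} {a1 : Admissible w1 S1} {a2 : Admissible w2 S2} →
        ParentPos u v a1 → ParentPos u v (graft c a1 a2)
  inr : ∀ {S x S1 S2 w1 w2} {c : Cut S x S1 S2} {a1 : Admissible w1 S1} {a2 : Admissible w2 S2} →
        ParentPos u v a2 → ParentPos u v (graft c a1 a2)

parentPos∈ : ∀ {u v w S} {a : Admissible w S} → ParentPos u v a → u ∈ edges S × v ∈ edges S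
parentPos∈ (here {c = c} {a1} (inj₁ g)) = CutFacts.cut∈ (cutFacts c) , CutFacts.edge₁ (cutFacts c) (rootEdge∈ a1 g)
parentPos∈ (here {c = c} {a2 = a2} (inj₂ g)) = CutFacts.cut∈ (cutFacts c) , CutFacts.edge₂ (cutFacts c) (rootEdge∈ a2 g)
parentPos∈ (inl {c = c} p) = let (x , y) = parentPos∈ p in CutFacts.edge₁ (cutFacts c) x , CutFacts.edge₁ (cutFacts c) y
parentPos∈ (inr {c = c} p) = let (x , y) = parentPos∈ p in CutFacts.edge₂ (cutFacts c) x , CutFacts.edge₂ (cutFacts c) y

rootLabel-Φ : ∀ {w S v} (a : Admissible w S) → Any (λ C → rootLabel C ≐ [ v ]) (Φs a) → RootEdge a v
rootLabel-Φ (graft c a1 a2) (here (f , _)) = AnyP.singleton⁻ (f (here refl))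

module _ {𝐇 : List TEdge → Set} where
  open Hypergraph _≟E_ 𝐇 using (ParentOf; here; there)

  mutual
    parentPos : ∀ {u v w1 w2 S} (a : Admissible (w1 · w2) S) → ParentOf u v (Φ a) → ParentPos u v a
    parentPos (graft c a1 a2) (here (f , _) rt) with AnyP.singleton⁻ (f (here refl))
    ... | refl with AnyP.++⁻ (Φs a1) rt
    ...   | inj₁ q = here (inj₁ (rootLabel-Φ a1 q))
    ...   | inj₂ q = here (inj₂ (rootLabel-Φ a2 q))
    parentPos (graft c a1 a2) (there p) with AnyP.++⁻ (Φs a1) p
    ... | inj₁ q = inl (parentPos* a1 q)
    ... | inj₂ q = inr (parentPos* a2 q)

    parentPos* : ∀ {u v w S} (a : Admissible w S) → Any (ParentOf u v) (Φs a) → ParentPos u v a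
    parentPos* (graft c a1 a2) (here p) = parentPos (graft c a1 a2) p

-- For trees with distinct letters, cuts at
-- the same edge then produce halves with the same roots and edges, because the
-- halves are characterised by ancestry (CutAnc).
_≅_ : Tree → Tree → Set
S ≅ S' = root S ≡ root S' × edges S ≐ edges S'

≅-sym : ∀ {S S'} → S ≅ S' → S' ≅ S
≅-sym (r , f , g) = sym r , g , f

cut≅ : ∀ {S S' x S1 S2 S1' S2'} → Distinct S → Distinct S' → S ≅ S' → Cut S x S1 S2 → Cut S' x S1' S2' →
       S1 ≅ S1' × S2 ≅ S2'
cut≅ {S} {S'} {x} {S1} {S2} {S1'} {S2'} w w' (rt , f , g) c c' =
  (trans C.root₁ (trans rt (sym C'.root₁)) , e1f , e1g) , (trans (sym C.root₂) C'.root₂ , e2f , e2g)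
  where
    module C = CutAnc c w
    module C' = CutAnc c' w'
    e2f : ∀ {e} → e ∈ edges S2 → e ∈ edges S2'
    e2f q = C'.anc⇒edge₂ (f (C.edge₂ q)) (anc-mono f (C.edge₂⇒anc q))
    e2g : ∀ {e} → e ∈ edges S2' → e ∈ edges S2
    e2g q = C.anc⇒edge₂ (g (C'.edge₂ q)) (anc-mono g (C'.edge₂⇒anc q))
    e1f : ∀ {e} → e ∈ edges S1 → e ∈ edges S1'
    e1f q = let (nx , nd) = C.edge₁⇒non-anc q in C'.non-anc⇒edge₁ (f (C.edge₁ q)) nx (λ d → nd (anc-mono g d))
    e1g : ∀ {e} → e ∈ edges S1' → e ∈ edges S1
    e1g q = let (nx , nd) = C'.edge₁⇒non-anc q in C.non-anc⇒edge₁ (g (C'.edge₁ q)) nx (λ d → nd (anc-mono f d))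

grafted-left : ∀ {S x S1 S2 w1 w2 x₀ y} {c : Cut S x S1 S2} {a1 : Admissible w1 S1} {a2 : Admissible w2 S2} →
               Distinct S → Grafted (graft c a1 a2) x₀ y → x₀ ∈ edges S1 → Grafted a1 x₀ y
grafted-left {c = c} w (top _) q = ⊥-elim (CutAnc.cut∉₁ c w q)
grafted-left w (onLeft b) q = b
grafted-left {c = c} w (onRight b) q = ⊥-elim (CutAnc.edge₁∉₂ c w q (proj₁ (grafted∈ b)))

grafted-right : ∀ {S x S1 S2 w1 w2 x₀ y} {c : Cut S x S1 S2} {a1 : Admissible w1 S1} {a2 : Admissible w2 S2} →
                Distinct S → Grafted (graft c a1 a2) x₀ y → x₀ ∈ edges S2 → Grafted a2 x₀ y
grafted-right {c = c} w (top _) q = ⊥-elim (CutAnc.cut∉₂ c w q)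
grafted-right {c = c} w (onLeft b) q = ⊥-elim (CutAnc.edge₁∉₂ c w (proj₁ (grafted∈ b)) q)
grafted-right w (onRight b) q = b

root-edge-agrees : ∀ {S' x x' S1' S2' w1' w2'} {c' : Cut S' x' S1' S2'}
                   {b1 : Admissible w1' S1'} {b2 : Admissible w2' S2'} → Distinct S' →
                   Grafted (graft c' b1 b2) x x' → x ≡ x'
root-edge-agrees w' (top _) = refl
root-edge-agrees {c' = c'} w' (onLeft b) = ⊥-elim (CutAnc.cut∉₁ c' w' (proj₂ (grafted∈ b)))
root-edge-agrees {c' = c'} w' (onRight b) = ⊥-elim (CutAnc.cut∉₂ c' w' (proj₂ (grafted∈ b)))

-- An admissible word is determined by its tree (up to ≅) and its grafting
-- order: the root grafting edge is the edge above all others, and induction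
-- on the two halves of the cut.
word-unique : ∀ {w w' S S'} (a : Admissible w S) (a' : Admissible w' S') → Distinct S → Distinct S' → S ≅ S' →
              (∀ {x y} → x ∈ edges S → Grafted a x y → Grafted a' x y) → w ≡ w'
word-unique ltr ltr _ _ (rt , _) _ = cong ltr rt
word-unique ltr (graft c' _ _) _ _ (_ , _ , g) _ with g (CutFacts.cut∈ (cutFacts c'))
... | ()
word-unique (graft c _ _) ltr _ _ (_ , f , _) _ with f (CutFacts.cut∈ (cutFacts c))
... | ()
word-unique (graft {x = x} c a1 a2) (graft {x = x'} c' b1 b2) w w' iso@(_ , f , g) h
  with root-edge-agrees {c' = c'} {b1 = b1} {b2 = b2} w'
         (h (CutFacts.cut∈ (cutFacts c)) (top {c = c} {a1} {a2} (g (CutFacts.cut∈ (cutFacts c')))))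
... | refl =
  let (i1 , i2) = cut≅ w w' iso c c'
  in cong₂ _·_
       (word-unique a1 b1 (CutAnc.distinct₁ c w) (CutAnc.distinct₁ c' w') i1
          (λ q b → grafted-left w' (h (CutFacts.edge₁ (cutFacts c) q) (onLeft b)) (proj₁ (proj₂ i1) q)))
       (word-unique a2 b2 (CutAnc.distinct₂ c w) (CutAnc.distinct₂ c' w') i2
          (λ q b → grafted-right w' (h (CutFacts.edge₂ (cutFacts c) q) (onRight b)) (proj₁ (proj₂ i2) q)))

Transfer : ∀ {w w' S S'} → TEdge → TEdge → Admissible w S → Admissible w' S' → Set
Transfer {S = S} u v a a' = ∀ {x y} → x ≢ u → x ≢ v → x ∈ edges S → Grafted a x y → Grafted a' x y

record Similar (u v : TEdge) {w w' S S'} (a : Admissible w S) (a' : Admissible w' S') : Set where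
  field
    distinct-S : Distinct S
    distinct-S' : Distinct S'
    same-shape : S ≅ S'
    transfer : Transfer u v a a'

∈∉⇒≢ : ∀ {A : Set} {E : List A} {x y} → x ∈ E → y ∉ E → x ≢ y
∈∉⇒≢ xE yE refl = yE xE

module AssocPieces {S S' u v S1 S2 S21 S22 S1' S2' S11' S12'} (w : Distinct S) (w' : Distinct S') (iso : S ≅ S')
                   (c : Cut S u S1 S2) (c2 : Cut S2 v S21 S22) (c' : Cut S' v S1' S2') (c1' : Cut S1' u S11' S12') where
  private
    module C = CutAnc c w
    module C2 = CutAnc c2 C.distinct₂
    module C' = CutAnc c' w'
    module C1' = CutAnc c1' C'.distinct₁
    f = proj₁ (proj₂ iso)
    g = proj₂ (proj₂ iso)
    dv : Anc (edges S) (proj₂ u) (proj₁ v)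
    dv = C.edge₂⇒anc C2.cut∈
    dcucv : Anc (edges S) (proj₂ u) (proj₂ v)
    dcucv = let (n , r) = dv in suc n , chain-snoc r (C.edge₂ C2.cut∈)
    cu∈S1' = child∈letters S1' C1'.cut∈
    cv∈S2 = child∈letters S2 C2.cut∈

  piece₁ : S1 ≅ S11'
  piece₁ = trans C.root₁ (trans (proj₁ iso) (sym (trans C1'.root₁ C'.root₁))) , to , from
    where
      to : ∀ {e} → e ∈ edges S1 → e ∈ edges S11'
      to q = let (nxu , ndu) = C.edge₁⇒non-anc q
                 q1' = C'.non-anc⇒edge₁ (f (C.edge₁ q)) (λ { refl → ndu dv }) (λ d → ndu (anc-trans dcucv (anc-mono g d)))
             in C1'.non-anc⇒edge₁ q1' nxu (λ d → ndu (anc-mono g (anc-mono C'.edge₁ d)))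
      from : ∀ {e} → e ∈ edges S11' → e ∈ edges S1
      from q = let q1' = C1'.edge₁ q
                   (nxu , ndu1') = C1'.edge₁⇒non-anc q
                   (_ , ndv') = C'.edge₁⇒non-anc q1'
               in C.non-anc⇒edge₁ (g (C'.edge₁ q1')) nxu (λ d → ndu1' (_ , C'.chain₁ (proj₂ (anc-mono f d)) cu∈S1' ndv'))

  piece₂ : S21 ≅ S12'
  piece₂ = trans C2.root₁ (trans (sym C.root₂) C1'.root₂) , to , from
    where
      to : ∀ {e} → e ∈ edges S21 → e ∈ edges S12'
      to q = let q2 = C2.edge₁ q
                 (nxv , ndv2) = C2.edge₁⇒non-anc q
                 ndv : ¬ Anc (edges S) (proj₂ v) _
                 ndv = λ { (n , r) → ndv2 (n , C.chain₂ r cv∈S2) }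
                 q1' = C'.non-anc⇒edge₁ (f (C.edge₂ q2)) nxv (λ d → ndv (anc-mono g d))
             in C1'.anc⇒edge₂ q1' (_ , C'.chain₁ (proj₂ (anc-mono f (C.edge₂⇒anc q2))) cu∈S1' (λ d → ndv (anc-mono g d)))
      from : ∀ {e} → e ∈ edges S12' → e ∈ edges S21
      from q = let q1' = C1'.edge₂ q
                   (nxv , ndv') = C'.edge₁⇒non-anc q1'
                   q2 = C.anc⇒edge₂ (g (C'.edge₁ q1')) (anc-mono g (anc-mono C'.edge₁ (C1'.edge₂⇒anc q)))
               in C2.non-anc⇒edge₁ q2 nxv (λ d → ndv' (anc-mono f (anc-mono C.edge₂ d)))

  piece₃ : S22 ≅ S2'
  piece₃ = trans (sym C2.root₂) C'.root₂ , to , from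
    where
      to : ∀ {e} → e ∈ edges S22 → e ∈ edges S2'
      to q = C'.anc⇒edge₂ (f (C.edge₂ (C2.edge₂ q))) (anc-mono f (anc-mono C.edge₂ (C2.edge₂⇒anc q)))
      from : ∀ {e} → e ∈ edges S2' → e ∈ edges S22
      from q = let (n , r) = anc-mono g (C'.edge₂⇒anc q)
                   r2 = C.chain₂ r cv∈S2
               in C2.anc⇒edge₂ (C.parent⇒edge₂ (g (C'.edge₂ q)) (chain-end∈ _ r2 cv∈S2)) (n , r2)

module TwistPieces {S S' u v S1 S2 S11 S12 S1' S2' S11' S12'} (w : Distinct S) (w' : Distinct S') (iso : S ≅ S')
                   (u≢v : u ≢ v) (c : Cut S u S1 S2) (c1 : Cut S1 v S11 S12)
                   (c' : Cut S' v S1' S2') (c1' : Cut S1' u S11' S12') where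
  private
    module C = CutAnc c w
    module C1 = CutAnc c1 C.distinct₁
    module C' = CutAnc c' w'
    module C1' = CutAnc c1' C'.distinct₁
    f = proj₁ (proj₂ iso)
    g = proj₂ (proj₂ iso)
    cv∈S1 = child∈letters S1 C1.cut∈
    cu∈S1' = child∈letters S1' C1'.cut∈

  u-not-above-v : ¬ Anc (edges S) (proj₂ u) (proj₁ v)
  u-not-above-v = proj₂ (C.edge₁⇒non-anc C1.cut∈)

  v-not-above-u' : ¬ Anc (edges S') (proj₂ v) (proj₁ u)
  v-not-above-u' = proj₂ (C'.edge₁⇒non-anc C1'.cut∈)

  private
    v-not-above-u : ¬ Anc (edges S) (proj₂ v) (proj₁ u)
    v-not-above-u d = v-not-above-u' (anc-mono f d)

    no-common-descendant : ∀ {b} → Anc (edges S) (proj₂ u) b → Anc (edges S) (proj₂ v) b → ⊥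
    no-common-descendant = incomparable-edges w C.cut∈ (C.edge₁ C1.cut∈) u≢v u-not-above-v v-not-above-u

  piece₁₁ : S11 ≅ S11'
  piece₁₁ = trans C1.root₁ (trans C.root₁ (trans (proj₁ iso) (sym (trans C1'.root₁ C'.root₁)))) , to , from
    where
      to : ∀ {e} → e ∈ edges S11 → e ∈ edges S11'
      to q = let q1 = C1.edge₁ q
                 (nu , ndu) = C.edge₁⇒non-anc q1
                 (nv , ndv1) = C1.edge₁⇒non-anc q
                 ndv : ¬ Anc (edges S) (proj₂ v) _
                 ndv = λ { (n , r) → ndv1 (n , C.chain₁ r cv∈S1 ndu) }
                 q1' = C'.non-anc⇒edge₁ (f (C.edge₁ q1)) nv (λ d → ndv (anc-mono g d))
             in C1'.non-anc⇒edge₁ q1' nu (λ d → ndu (anc-mono g (anc-mono C'.edge₁ d)))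
      from : ∀ {e} → e ∈ edges S11' → e ∈ edges S11
      from q = let q1' = C1'.edge₁ q
                   (nv , ndv') = C'.edge₁⇒non-anc q1'
                   (nu , ndu1') = C1'.edge₁⇒non-anc q
                   ndu' : ¬ Anc (edges S') (proj₂ u) _
                   ndu' = λ { (n , r) → ndu1' (n , C'.chain₁ r cu∈S1' ndv') }
                   q1 = C.non-anc⇒edge₁ (g (C'.edge₁ q1')) nu (λ d → ndu' (anc-mono f d))
               in C1.non-anc⇒edge₁ q1 nv (λ d → ndv' (anc-mono f (anc-mono C.edge₁ d)))

  piece₁₂ : S12 ≅ S2'
  piece₁₂ = trans (sym C1.root₂) C'.root₂ , to , from
    where
      to : ∀ {e} → e ∈ edges S12 → e ∈ edges S2'
      to q = C'.anc⇒edge₂ (f (C.edge₁ (C1.edge₂ q))) (anc-mono f (anc-mono C.edge₁ (C1.edge₂⇒anc q)))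
      from : ∀ {e} → e ∈ edges S2' → e ∈ edges S12
      from q = let d = anc-mono g (C'.edge₂⇒anc q)
                   (n , r) = d
                   r1 = C.chain₁ r cv∈S1 (λ du → no-common-descendant du d)
               in C1.anc⇒edge₂ (C.parent⇒edge₁ (g (C'.edge₂ q)) (chain-end∈ _ r1 cv∈S1) (λ { refl → v-not-above-u d }))
                                (n , r1)

  piece₂ : S2 ≅ S12'
  piece₂ = trans (sym C.root₂) C1'.root₂ , to , from
    where
      to : ∀ {e} → e ∈ edges S2 → e ∈ edges S12'
      to q = let d = C.edge₂⇒anc q
                 (n , r) = anc-mono f d
                 r1 = C'.chain₁ r cu∈S1' (λ dv → no-common-descendant d (anc-mono g dv))
             in C1'.anc⇒edge₂ (C'.parent⇒edge₁ (f (C.edge₂ q)) (chain-end∈ _ r1 cu∈S1') (λ { refl → u-not-above-v d }))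
                               (n , r1)
      from : ∀ {e} → e ∈ edges S12' → e ∈ edges S2
      from q = C.anc⇒edge₂ (g (C'.edge₁ (C1'.edge₂ q))) (anc-mono g (anc-mono C'.edge₁ (C1'.edge₂⇒anc q)))

assoc-from-≡ : ∀ {w1 w2 w3 x1 x2 x3} → w1 ≡ x1 → w2 ≡ x2 → w3 ≡ x3 → AssocStep ((x1 · x2) · x3) (w1 · (w2 · w3))
assoc-from-≡ refl refl refl = here

twist-from-≡ : ∀ {w1 w2 w3 x1 x2 x3} → w1 ≡ x1 → w2 ≡ x3 → w3 ≡ x2 → TwistStep ((w1 · w2) · w3) ((x1 · x2) · x3)
twist-from-≡ refl refl refl = here

-- The three pieces coincide, so the remaining subwords coincide by word-unique.
assoc-step : ∀ {u v S S' S1 S2 S21 S22 S1' S2' S11' S12' w1 w21 w22 x11 x12 x2}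
  {c : Cut S u S1 S2} {c2 : Cut S2 v S21 S22} {c' : Cut S' v S1' S2'} {c1' : Cut S1' u S11' S12'}
  (a1 : Admissible w1 S1) (a21 : Admissible w21 S21) (a22 : Admissible w22 S22)
  (b11 : Admissible x11 S11') (b12 : Admissible x12 S12') (b2 : Admissible x2 S2') →
  Similar u v (graft c a1 (graft c2 a21 a22)) (graft c' (graft c1' b11 b12) b2) →
  AssocStep ((x11 · x12) · x2) (w1 · (w21 · w22))
assoc-step {S1 = S1} {S21 = S21} {S22 = S22} {c = c} {c2} {c'} {c1'} a1 a21 a22 b11 b12 b2 sim =
  assoc-from-≡ (word-unique a1 b11 C.distinct₁ C1'.distinct₁ piece₁ h1)
               (word-unique a21 b12 C2.distinct₁ C1'.distinct₂ piece₂ h2)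
               (word-unique a22 b2 C2.distinct₂ C'.distinct₂ piece₃ h3)
  where
    open Similar sim
    open AssocPieces distinct-S distinct-S' same-shape c c2 c' c1'
    module C = CutAnc c distinct-S
    module C2 = CutAnc c2 C.distinct₂
    module C' = CutAnc c' distinct-S'
    module C1' = CutAnc c1' C'.distinct₁
    h1 : ∀ {x y} → x ∈ edges S1 → Grafted a1 x y → Grafted b11 x y
    h1 q b = let q' = proj₁ (proj₂ piece₁) q in
      grafted-left C'.distinct₁
        (grafted-left distinct-S' (transfer (∈∉⇒≢ q C.cut∉₁) (λ { refl → C.edge₁∉₂ q (C2.cut∈) }) (C.edge₁ q) (onLeft b))
                      (C1'.edge₁ q')) q'
    h2 : ∀ {x y} → x ∈ edges S21 → Grafted a21 x y → Grafted b12 x y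
    h2 q b = let q' = proj₁ (proj₂ piece₂) q in
      grafted-right C'.distinct₁
        (grafted-left distinct-S' (transfer (∈∉⇒≢ (C2.edge₁ q) C.cut∉₂) (∈∉⇒≢ q C2.cut∉₁) (C.edge₂ (C2.edge₁ q))
                                          (onRight (onLeft b)))
                      (C1'.edge₂ q')) q'
    h3 : ∀ {x y} → x ∈ edges S22 → Grafted a22 x y → Grafted b2 x y
    h3 q b = grafted-right distinct-S' (transfer (∈∉⇒≢ (C2.edge₂ q) C.cut∉₂) (∈∉⇒≢ q C2.cut∉₂) (C.edge₂ (C2.edge₂ q))
                                               (onRight (onRight b)))
                           (proj₁ (proj₂ piece₃) q)

twist-step : ∀ {u v S S' S1 S2 S11 S12 S1' S2' S11' S12' w11 w12 w2 x11 x12 x2}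
  {c : Cut S u S1 S2} {c1 : Cut S1 v S11 S12} {c' : Cut S' v S1' S2'} {c1' : Cut S1' u S11' S12'}
  (a11 : Admissible w11 S11) (a12 : Admissible w12 S12) (a2 : Admissible w2 S2)
  (b11 : Admissible x11 S11') (b12 : Admissible x12 S12') (b2 : Admissible x2 S2') → u ≢ v →
  Similar u v (graft c (graft c1 a11 a12) a2) (graft c' (graft c1' b11 b12) b2) →
  TwistStep ((w11 · w12) · w2) ((x11 · x12) · x2)
twist-step {S2 = S2} {S11 = S11} {S12 = S12} {c = c} {c1} {c'} {c1'} a11 a12 a2 b11 b12 b2 u≢v sim =
  twist-from-≡ (word-unique a11 b11 C1.distinct₁ C1'.distinct₁ piece₁₁ h11)
               (word-unique a12 b2 C1.distinct₂ C'.distinct₂ piece₁₂ h12)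
               (word-unique a2 b12 C.distinct₂ C1'.distinct₂ piece₂ h2)
  where
    open Similar sim
    open TwistPieces distinct-S distinct-S' same-shape u≢v c c1 c' c1'
    module C = CutAnc c distinct-S
    module C1 = CutAnc c1 C.distinct₁
    module C' = CutAnc c' distinct-S'
    module C1' = CutAnc c1' C'.distinct₁
    h11 : ∀ {x y} → x ∈ edges S11 → Grafted a11 x y → Grafted b11 x y
    h11 q b = let q' = proj₁ (proj₂ piece₁₁) q in
      grafted-left C'.distinct₁
        (grafted-left distinct-S' (transfer (∈∉⇒≢ (C1.edge₁ q) C.cut∉₁) (∈∉⇒≢ q C1.cut∉₁) (C.edge₁ (C1.edge₁ q))
                                          (onLeft (onLeft b)))
                      (C1'.edge₁ q')) q'
    h12 : ∀ {x y} → x ∈ edges S12 → Grafted a12 x y → Grafted b2 x y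
    h12 q b = grafted-right distinct-S' (transfer (∈∉⇒≢ (C1.edge₂ q) C.cut∉₁) (∈∉⇒≢ q C1.cut∉₂) (C.edge₁ (C1.edge₂ q))
                                                (onLeft (onRight b)))
                            (proj₁ (proj₂ piece₁₂) q)
    h2 : ∀ {x y} → x ∈ edges S2 → Grafted a2 x y → Grafted b12 x y
    h2 q b = let q' = proj₁ (proj₂ piece₂) q in
      grafted-right C'.distinct₁
        (grafted-left distinct-S' (transfer (∈∉⇒≢ q C.cut∉₂) (λ { refl → C.edge₁∉₂ C1.cut∈ q }) (C.edge₂ q) (onRight b))
                      (C1'.edge₂ q')) q'

non-anc-lift : ∀ {𝒯 S u v} → Distinct 𝒯 → edges S ⊆ edges 𝒯 → u ∈ edges S → v ∈ edges S →
               ¬ Anc (edges S) (proj₂ u) (proj₁ v) → ¬ Anc (edges 𝒯) (proj₂ u) (proj₁ v)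
non-anc-lift {S = S} w𝒯 S⊆𝒯 uS vS nd d =
  nd (anc-restrict {S = S} w𝒯 S⊆𝒯 (proj₂ (root-anc S (parent∈letters S vS)))
       (anc-mono S⊆𝒯 (let (n , r) = root-anc S (parent∈letters S uS) in suc n , chain-snoc r uS)) d)

module Descent (𝒯 : Tree) (w𝒯 : Distinct 𝒯) (u v : TEdge) (u≢v : u ≢ v) where

  -- the invariant: a and a' agree except at u and v, and u's position in a
  -- is v's position in a'
  record Matched {w w' S S'} (a : Admissible w S) (a' : Admissible w' S') : Set where
    field
      similar : Similar u v a a'
      transfer' : Transfer u v a' a
      u↦v : ∀ {y} → Grafted a u y → Grafted a' v y
      in𝒯 : edges S ⊆ edges 𝒯
    open Similar similar public

  data Outcome (w w' : Word) : Set where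
    assocUV : AssocStep w' w → Anc (edges 𝒯) (proj₂ u) (proj₁ v) → Outcome w w'
    assocVU : AssocStep w w' → Anc (edges 𝒯) (proj₂ v) (proj₁ u) → Outcome w w'
    twist : TwistStep w w' → ¬ Anc (edges 𝒯) (proj₂ u) (proj₁ v) → ¬ Anc (edges 𝒯) (proj₂ v) (proj₁ u) →
            Outcome w w'

  outcome-left : ∀ {w w' z} → Outcome w w' → Outcome (w · z) (w' · z)
  outcome-left (assocUV s d) = assocUV (left s) d
  outcome-left (assocVU s d) = assocVU (left s) d
  outcome-left (twist s d e) = twist (left s) d e

  outcome-right : ∀ {w w' z} → Outcome w w' → Outcome (z · w) (z · w')
  outcome-right (assocUV s d) = assocUV (right s) d
  outcome-right (assocVU s d) = assocVU (right s) d
  outcome-right (twist s d e) = twist (right s) d e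

  -- At the node where a grafts u and a' grafts v, one of v, u is grafted
  -- just below.  Both lower: impossible (u, v would be below each other);
  -- lower and upper: associativity; both upper: twist.
  node-step : ∀ {S S' S1 S2 S1' S2' w1 w2 w1' w2'} {c : Cut S u S1 S2} {c' : Cut S' v S1' S2'}
              (a1 : Admissible w1 S1) (a2 : Admissible w2 S2) (b1 : Admissible w1' S1') (b2 : Admissible w2' S2') →
              Matched (graft c a1 a2) (graft c' b1 b2) → RootEdge a1 v ⊎ RootEdge a2 v → RootEdge b1 u ⊎ RootEdge b2 u →
              Outcome (w1 · w2) (w1' · w2')
  node-step {c = c} a1 (graft c2 a21 a22) (graft c1' b11 b12) b2 m (inj₂ refl) (inj₁ refl) =
    assocUV (assoc-step a1 a21 a22 b11 b12 b2 similar)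
            (anc-mono in𝒯 (CutAnc.edge₂⇒anc c distinct-S (CutFacts.cut∈ (cutFacts c2))))
    where open Matched m
  node-step {c = c} {c'} a1 (graft c2 a21 a22) b1 b2 m (inj₂ refl) (inj₂ gu) =
    ⊥-elim (u≢v (anc-cycle distinct-S (CutFacts.cut∈ (cutFacts c)) (CutFacts.edge₂ (cutFacts c) (CutFacts.cut∈ (cutFacts c2)))
                  (CutAnc.edge₂⇒anc c distinct-S (CutFacts.cut∈ (cutFacts c2)))
                  (anc-mono (proj₂ (proj₂ same-shape)) (CutAnc.edge₂⇒anc c' distinct-S' (rootEdge∈ b2 gu)))))
    where open Matched m
  node-step {S} {S'} {c' = c'} (graft c1 a11 a12) a2 b1 (graft c2' b21 b22) m (inj₁ refl) (inj₂ refl) =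
    assocVU (assoc-step b1 b21 b22 a11 a12 a2 flipped)
            (anc-mono (λ q → in𝒯 (proj₂ (proj₂ same-shape) q)) (CutAnc.edge₂⇒anc c' distinct-S' (CutFacts.cut∈ (cutFacts c2'))))
    where
      open Matched m
      flipped : Similar v u _ _
      flipped = record { distinct-S = distinct-S' ; distinct-S' = distinct-S ; same-shape = ≅-sym {S} {S'} same-shape
                       ; transfer = λ nv nu → transfer' nu nv }
  node-step {S} {S'} {c = c} {c'} (graft c1 a11 a12) a2 (graft c1' b11 b12) b2 m (inj₁ refl) (inj₁ refl) =
    twist (twist-step a11 a12 a2 b11 b12 b2 u≢v similar)
          (non-anc-lift {S = S} w𝒯 in𝒯 (CutFacts.cut∈ (cutFacts c)) (CutFacts.edge₁ (cutFacts c) (CutFacts.cut∈ (cutFacts c1)))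
                        u-not-above-v)
          (non-anc-lift {S = S'} w𝒯 (λ q → in𝒯 (proj₂ (proj₂ same-shape) q)) (CutFacts.cut∈ (cutFacts c'))
                        (CutFacts.edge₁ (cutFacts c') (CutFacts.cut∈ (cutFacts c1'))) v-not-above-u')
    where
      open Matched m
      open TwistPieces distinct-S distinct-S' same-shape u≢v c c1 c' c1'
  node-step ltr a2 b1 b2 m (inj₁ ()) _
  node-step a1 ltr b1 b2 m (inj₂ ()) _
  node-step a1 a2 ltr b2 m _ (inj₁ ())
  node-step a1 a2 b1 ltr m _ (inj₂ ())

  root-agrees : ∀ {S S' x x' S1 S2 S1' S2' w1 w2 w1' w2'} {c : Cut S x S1 S2} {c' : Cut S' x' S1' S2'}
                {a1 : Admissible w1 S1} {a2 : Admissible w2 S2} {b1 : Admissible w1' S1'} {b2 : Admissible w2' S2'} →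
                Matched (graft c a1 a2) (graft c' b1 b2) → x ≢ u → x ≢ v → x ≡ x'
  root-agrees {c = c} {c'} {b1 = b1} {b2 = b2} m xu xv =
    root-edge-agrees {c' = c'} {b1 = b1} {b2 = b2} distinct-S'
      (transfer xu xv (CutFacts.cut∈ (cutFacts c)) (top (proj₂ (proj₂ same-shape) (CutFacts.cut∈ (cutFacts c')))))
    where open Matched m

  root-u↦v : ∀ {S S' x' S1 S2 S1' S2' w1 w2 w1' w2'} {c : Cut S u S1 S2} {c' : Cut S' x' S1' S2'}
             {a1 : Admissible w1 S1} {a2 : Admissible w2 S2} {b1 : Admissible w1' S1'} {b2 : Admissible w2' S2'} →
             Matched (graft c a1 a2) (graft c' b1 b2) → v ≡ x'
  root-u↦v {c' = c'} {b1 = b1} {b2 = b2} m =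
    root-edge-agrees {c' = c'} {b1 = b1} {b2 = b2} distinct-S' (u↦v (top (proj₂ (proj₂ same-shape) (CutFacts.cut∈ (cutFacts c')))))
    where open Matched m

  module Halves {S S' x S1 S2 S1' S2' w1 w2 w1' w2'} {c : Cut S x S1 S2} {c' : Cut S' x S1' S2'}
                {a1 : Admissible w1 S1} {a2 : Admissible w2 S2} {b1 : Admissible w1' S1'} {b2 : Admissible w2' S2'}
                (m : Matched (graft c a1 a2) (graft c' b1 b2)) where
    open Matched m
    private
      module C = CutAnc c distinct-S
      module C' = CutAnc c' distinct-S'
      i1 = proj₁ (cut≅ distinct-S distinct-S' same-shape c c')
      i2 = proj₂ (cut≅ distinct-S distinct-S' same-shape c c')

    matched₁ : v ∈ edges S1 → Matched a1 b1
    matched₁ v∈1 = record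
      { similar = record { distinct-S = C.distinct₁ ; distinct-S' = C'.distinct₁ ; same-shape = i1
                         ; transfer = λ nu nv q b → grafted-left distinct-S' (transfer nu nv (C.edge₁ q) (onLeft b))
                                                                 (proj₁ (proj₂ i1) q) }
      ; transfer' = λ nu nv q b → grafted-left distinct-S (transfer' nu nv (C'.edge₁ q) (onLeft b)) (proj₂ (proj₂ i1) q)
      ; u↦v = λ b → grafted-left distinct-S' (u↦v (onLeft b)) (proj₁ (proj₂ i1) v∈1)
      ; in𝒯 = λ q → in𝒯 (C.edge₁ q) }

    matched₂ : v ∈ edges S2 → Matched a2 b2
    matched₂ v∈2 = record
      { similar = record { distinct-S = C.distinct₂ ; distinct-S' = C'.distinct₂ ; same-shape = i2
                         ; transfer = λ nu nv q b → grafted-right distinct-S' (transfer nu nv (C.edge₂ q) (onRight b))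
                                                                  (proj₁ (proj₂ i2) q) }
      ; transfer' = λ nu nv q b → grafted-right distinct-S (transfer' nu nv (C'.edge₂ q) (onRight b)) (proj₂ (proj₂ i2) q)
      ; u↦v = λ b → grafted-right distinct-S' (u↦v (onRight b)) (proj₁ (proj₂ i2) v∈2)
      ; in𝒯 = λ q → in𝒯 (C.edge₂ q) }

    equal₂ : u ∈ edges S1 → v ∈ edges S1 → w2 ≡ w2'
    equal₂ u∈1 v∈1 = word-unique a2 b2 C.distinct₂ C'.distinct₂ i2
      (λ q b → grafted-right distinct-S' (transfer (λ { refl → C.edge₁∉₂ u∈1 q }) (λ { refl → C.edge₁∉₂ v∈1 q })
                                                   (C.edge₂ q) (onRight b))
                             (proj₁ (proj₂ i2) q))

    equal₁ : u ∈ edges S2 → v ∈ edges S2 → w1 ≡ w1'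
    equal₁ u∈2 v∈2 = word-unique a1 b1 C.distinct₁ C'.distinct₁ i1
      (λ q b → grafted-left distinct-S' (transfer (λ { refl → C.edge₁∉₂ q u∈2 }) (λ { refl → C.edge₁∉₂ q v∈2 })
                                                  (C.edge₁ q) (onLeft b))
                            (proj₁ (proj₂ i1) q))

    not-crossed₁₂ : u ∈ edges S1 → u ∉ edges S2'
    not-crossed₁₂ u∈1 u∈2' = C.edge₁∉₂ u∈1 (proj₂ (proj₂ i2) u∈2')

    not-crossed₂₁ : u ∈ edges S2 → u ∉ edges S1'
    not-crossed₂₁ u∈2 u∈1' = C.edge₁∉₂ (proj₂ (proj₂ i1) u∈1') u∈2

  -- Main descent: follow the common path of a and a' down to the node where
  -- a grafts u (and a' grafts v) and apply node-step there.
  descend : ∀ {w w' S S'} (a : Admissible w S) (a' : Admissible w' S') → Matched a a' →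
            ParentPos u v a → ParentPos v u a' → Outcome w w'
  descend (graft c a1 a2) (graft c' b1 b2) m (here p) (here p') = node-step a1 a2 b1 b2 m p p'
  descend (graft c a1 a2) (graft c' b1 b2) m (here _) (inl p') with root-u↦v m
  ... | refl = ⊥-elim (CutAnc.cut∉₁ c' (Matched.distinct-S' m) (proj₁ (parentPos∈ p')))
  descend (graft c a1 a2) (graft c' b1 b2) m (here _) (inr p') with root-u↦v m
  ... | refl = ⊥-elim (CutAnc.cut∉₂ c' (Matched.distinct-S' m) (proj₁ (parentPos∈ p')))
  descend (graft c a1 a2) (graft c' b1 b2) m (inl p) p'
    with root-agrees m (∈∉⇒≢ (proj₁ (parentPos∈ p)) (CutAnc.cut∉₁ c (Matched.distinct-S m)) ∘ sym)
                       (∈∉⇒≢ (proj₂ (parentPos∈ p)) (CutAnc.cut∉₁ c (Matched.distinct-S m)) ∘ sym)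
  ... | refl = descend₁ p p'
    where
      open Halves m
      descend₁ : ParentPos u v a1 → ParentPos v u (graft c' b1 b2) → Outcome _ _
      descend₁ p (here _) = ⊥-elim (CutAnc.cut∉₁ c (Matched.distinct-S m) (proj₂ (parentPos∈ p)))
      descend₁ p (inl p') = subst (λ z → Outcome _ (_ · z)) (equal₂ (proj₁ (parentPos∈ p)) (proj₂ (parentPos∈ p)))
                                  (outcome-left (descend a1 b1 (matched₁ (proj₂ (parentPos∈ p))) p p'))
      descend₁ p (inr p') = ⊥-elim (not-crossed₁₂ (proj₁ (parentPos∈ p)) (proj₂ (parentPos∈ p')))
  descend (graft c a1 a2) (graft c' b1 b2) m (inr p) p'
    with root-agrees m (∈∉⇒≢ (proj₁ (parentPos∈ p)) (CutAnc.cut∉₂ c (Matched.distinct-S m)) ∘ sym)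
                       (∈∉⇒≢ (proj₂ (parentPos∈ p)) (CutAnc.cut∉₂ c (Matched.distinct-S m)) ∘ sym)
  ... | refl = descend₂ p p'
    where
      open Halves m
      descend₂ : ParentPos u v a2 → ParentPos v u (graft c' b1 b2) → Outcome _ _
      descend₂ p (here _) = ⊥-elim (CutAnc.cut∉₂ c (Matched.distinct-S m) (proj₂ (parentPos∈ p)))
      descend₂ p (inl p') = ⊥-elim (not-crossed₂₁ (proj₁ (parentPos∈ p)) (proj₂ (parentPos∈ p')))
      descend₂ p (inr p') = subst (λ z → Outcome _ (z · _)) (equal₁ (proj₁ (parentPos∈ p)) (proj₂ (parentPos∈ p)))
                                  (outcome-right (descend a2 b2 (matched₂ (proj₂ (parentPos∈ p))) p p'))

-- The geometry of 𝔾(𝒯): levels change by at most one along an edge of 𝔾(𝒯),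
-- and by exactly one along solid edges.  Hence a walk from u to v has length at
-- least the level difference, with equality only for all-solid walks; and an
-- all-solid geodesic goes monotonically down or up, i.e. one of u, v is an
-- ancestor edge of the other.

walk-ends∈ : ∀ {t e f} → Walk t e f → e ∈ edges t × f ∈ edges t
walk-ends∈ ([] q) = q , q
walk-ends∈ ((q , _) ∷ w) = q , proj₂ (walk-ends∈ w)

module Geometry (𝒯 : Tree) (w𝒯 : Distinct 𝒯) where

  level-exists : ∀ {e} → e ∈ edges 𝒯 → Σ ℕ (Level 𝒯 e)
  level-exists q = depth-exists 𝒯 (child∈letters 𝒯 q)

  level-step : ∀ {e g de dg} → Adj 𝒯 e g → Level 𝒯 e de → Level 𝒯 g dg →
               dg ≡ de ⊎ (Solid e g × dg ≡ suc de) ⊎ (Solid e g × de ≡ suc dg)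
  level-step {p , c} {p' , c'} (eq , gq , _ , inj₁ refl) le lg =
    let (dp , hp) = depth-exists 𝒯 (parent∈letters 𝒯 eq)
    in inj₁ (trans (depth-unique w𝒯 lg (depth-edge w𝒯 gq hp)) (sym (depth-unique w𝒯 le (depth-edge w𝒯 eq hp))))
  level-step {p , c} {p' , c'} (eq , gq , _ , inj₂ (inj₁ refl)) le lg =
    inj₂ (inj₂ (inj₂ refl , depth-unique w𝒯 le (depth-edge w𝒯 eq lg)))
  level-step {p , c} {p' , c'} (eq , gq , _ , inj₂ (inj₂ (inj₁ refl))) le lg =
    inj₂ (inj₁ (inj₁ refl , depth-unique w𝒯 lg (depth-edge w𝒯 gq le)))
  level-step {p , c} {p' , c'} (eq , gq , _ , inj₂ (inj₂ (inj₂ refl))) le lg = inj₁ (depth-unique w𝒯 lg le)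

  -- a step that does not increase the level cannot be part of a walk whose
  -- length equals the level difference
  private
    flat-step : ∀ a b → a + suc b ≰ a + b
    flat-step a b h = ℕₚ.1+n≰n (subst (_≤ a + b) (ℕₚ.+-suc a b) h)

    up-step : ∀ a b → suc (a + suc b) ≰ a + b
    up-step a b h = flat-step a b (ℕₚ.≤-trans (ℕₚ.n≤1+n _) h)

  walk-level-down : ∀ {e f de df} (W : Walk 𝒯 e f) → Level 𝒯 e de → Level 𝒯 f df →
                    df ≤ de + walkLength W × (df ≡ de + walkLength W → AllSolid W)
  walk-level-down {de = de} ([] q) le lf with depth-unique w𝒯 lf le
  ... | refl = ℕₚ.m≤m+n de 0 , λ _ → tt
  walk-level-down {de = de} {df} (_∷_ {f = g} ad W) le lf with level-exists (proj₁ (proj₂ ad))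
  ... | (dg , lg) with walk-level-down W lg lf | level-step ad le lg
  ...   | (h , k) | inj₁ refl = subst (df ≤_) (sym (ℕₚ.+-suc de _)) (ℕₚ.≤-trans h (ℕₚ.n≤1+n _)) ,
                                λ e → ⊥-elim (flat-step de _ (subst (_≤ _) e h))
  ...   | (h , k) | inj₂ (inj₁ (s , refl)) = subst (df ≤_) (sym (ℕₚ.+-suc de _)) h ,
                                λ e → s , k (trans e (ℕₚ.+-suc de _))
  ...   | (h , k) | inj₂ (inj₂ (s , refl)) =
          ℕₚ.≤-trans h (ℕₚ.≤-trans (ℕₚ.+-monoʳ-≤ dg (ℕₚ.n≤1+n _)) (ℕₚ.n≤1+n _)) ,
          λ e → ⊥-elim (up-step dg _ (subst (_≤ _) e h))

  walk-level-up : ∀ {e f de df} (W : Walk 𝒯 e f) → Level 𝒯 e de → Level 𝒯 f df →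
                  de ≤ df + walkLength W × (de ≡ df + walkLength W → AllSolid W)
  walk-level-up {de = de} ([] q) le lf with depth-unique w𝒯 lf le
  ... | refl = ℕₚ.m≤m+n de 0 , λ _ → tt
  walk-level-up {de = de} {df} (_∷_ {f = g} ad W) le lf with level-exists (proj₁ (proj₂ ad))
  ... | (dg , lg) with walk-level-up W lg lf | level-step ad le lg
  ...   | (h , k) | inj₁ refl = subst (de ≤_) (sym (ℕₚ.+-suc df _)) (ℕₚ.≤-trans h (ℕₚ.n≤1+n _)) ,
                                λ e → ⊥-elim (flat-step df _ (subst (_≤ _) e h))
  ...   | (h , k) | inj₂ (inj₁ (s , refl)) =
          subst (de ≤_) (sym (ℕₚ.+-suc df _)) (ℕₚ.≤-trans (ℕₚ.n≤1+n de) (ℕₚ.≤-trans h (ℕₚ.n≤1+n _))) ,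
          λ e → ⊥-elim (up-step df _ (subst (λ z → suc z ≤ _) e h))
  ...   | (h , k) | inj₂ (inj₂ (s , refl)) = subst (suc dg ≤_) (sym (ℕₚ.+-suc df _)) (s≤s h) ,
          λ e → s , k (ℕₚ.suc-injective (trans e (ℕₚ.+-suc df _)))

  solid-adj : ∀ {e g} → e ∈ edges 𝒯 → g ∈ edges 𝒯 → proj₂ e ≡ proj₁ g → Adj 𝒯 e g
  solid-adj {e} eq gq x = eq , gq , (λ { refl → parent≢child 𝒯 w𝒯 eq (sym x) }) , inj₂ (inj₂ (inj₁ x))

  chain-walk : ∀ {a b n} → Chain (edges 𝒯) a b n → ∀ {e f} → e ∈ edges 𝒯 → proj₂ e ≡ a → f ∈ edges 𝒯 → proj₁ f ≡ b →
               Σ (Walk 𝒯 e f) λ W → walkLength W ≡ suc n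
  chain-walk stay eq refl fq refl = solid-adj eq fq refl ∷ [] fq , refl
  chain-walk (link q r) eq refl fq x = let (W , l) = chain-walk r q refl fq x in solid-adj eq q refl ∷ W , cong suc l

  adj-sym : ∀ {e f} → Adj 𝒯 e f → Adj 𝒯 f e
  adj-sym (eq , fq , ne , sh) = fq , eq , (λ x → ne (sym x)) , share-sym sh
    where
      share-sym : ∀ {e f} → ShareNode e f → ShareNode f e
      share-sym (inj₁ x) = inj₁ (sym x)
      share-sym (inj₂ (inj₁ x)) = inj₂ (inj₂ (inj₁ (sym x)))
      share-sym (inj₂ (inj₂ (inj₁ x))) = inj₂ (inj₁ (sym x))
      share-sym (inj₂ (inj₂ (inj₂ x))) = inj₂ (inj₂ (inj₂ (sym x)))

  walk-snoc : ∀ {e f g} (W : Walk 𝒯 e f) → Adj 𝒯 f g → Σ (Walk 𝒯 e g) λ W' → walkLength W' ≡ suc (walkLength W)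
  walk-snoc ([] q) ad = ad ∷ [] (proj₁ (proj₂ ad)) , refl
  walk-snoc (ad' ∷ W) ad = let (W' , l) = walk-snoc W ad in ad' ∷ W' , cong suc l

  walk-reverse : ∀ {e f} (W : Walk 𝒯 e f) → Σ (Walk 𝒯 f e) λ W' → walkLength W' ≡ walkLength W
  walk-reverse ([] q) = [] q , refl
  walk-reverse (ad ∷ W) =
    let (R , l) = walk-reverse W
        (R' , l') = walk-snoc R (adj-sym ad)
    in R' , trans l' (cong suc l)

  descent⇒solid : ∀ {u v} → Anc (edges 𝒯) (proj₂ u) (proj₁ v) → (P : Walk 𝒯 u v) → Geodesic P →
                  Σ ℕ λ du → Σ ℕ λ dv → Level 𝒯 u du × Level 𝒯 v dv × du < dv × AllSolid P
  descent⇒solid {u} {v} (n , r) P geo =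
    let (u∈ , v∈) = walk-ends∈ P
        (du , lu) = level-exists u∈
        lv : Level 𝒯 v (du + suc n)
        lv = subst (Depth 𝒯 (proj₂ v)) (trans (cong suc (ℕₚ.+-comm n du)) (sym (ℕₚ.+-suc du n)))
                   (depth-edge w𝒯 v∈ (chain-depth w𝒯 r lu))
        (Q , lQ) = chain-walk r u∈ refl v∈ refl
        (h , k) = walk-level-down P lu lv
        h' : du + walkLength P ≤ du + suc n
        h' = ℕₚ.+-monoʳ-≤ du (subst (walkLength P ≤_) lQ (geo Q))
    in du , du + suc n , lu , lv , ℕₚ.m<m+n du (s≤s z≤n) , k (ℕₚ.≤-antisym h h')

  ascent⇒solid : ∀ {u v} → Anc (edges 𝒯) (proj₂ v) (proj₁ u) → (P : Walk 𝒯 u v) → Geodesic P →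
                 Σ ℕ λ du → Σ ℕ λ dv → Level 𝒯 u du × Level 𝒯 v dv × dv < du × AllSolid P
  ascent⇒solid {u} {v} (n , r) P geo =
    let (u∈ , v∈) = walk-ends∈ P
        (dv , lv) = level-exists v∈
        lu : Level 𝒯 u (dv + suc n)
        lu = subst (Depth 𝒯 (proj₂ u)) (trans (cong suc (ℕₚ.+-comm n dv)) (sym (ℕₚ.+-suc dv n)))
                   (depth-edge w𝒯 u∈ (chain-depth w𝒯 r lv))
        (Q , lQ) = chain-walk r v∈ refl u∈ refl
        (R , lR) = walk-reverse Q
        (h , k) = walk-level-up P lu lv
        h' : dv + walkLength P ≤ dv + suc n
        h' = ℕₚ.+-monoʳ-≤ dv (subst (walkLength P ≤_) (trans lR lQ) (geo R))
    in dv + suc n , dv , lu , lv , ℕₚ.m<m+n dv (s≤s z≤n) , k (ℕₚ.≤-antisym h h')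

  Down : ∀ {e f} → Walk 𝒯 e f → Set
  Down ([] _) = ⊤
  Down (_∷_ {e} {g} _ W) = proj₂ e ≡ proj₁ g × Down W

  Up : ∀ {e f} → Walk 𝒯 e f → Set
  Up ([] _) = ⊤
  Up (_∷_ {e} {g} _ W) = proj₂ g ≡ proj₁ e × Up W

  geodesic-tail : ∀ {e g f} (ad : Adj 𝒯 e g) (W : Walk 𝒯 g f) → Geodesic (ad ∷ W) → Geodesic W
  geodesic-tail ad W geo W' = ℕₚ.≤-pred (geo (ad ∷ W'))

  -- a solid geodesic cannot turn: down-then-up returns to the same edge (a
  -- node has one parent edge) and up-then-down joins two siblings, both of
  -- which could be shortcut
  solid-geodesic-monotone : ∀ {e f} (W : Walk 𝒯 e f) → Geodesic W → AllSolid W → Down W ⊎ Up W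
  solid-geodesic-monotone ([] _) _ _ = inj₁ tt
  solid-geodesic-monotone (ad ∷ W) geo (s , as) with solid-geodesic-monotone W (geodesic-tail ad W geo) as
  solid-geodesic-monotone (ad ∷ W) geo (inj₁ d , as) | inj₁ dW = inj₁ (d , dW)
  solid-geodesic-monotone (ad ∷ W) geo (inj₂ u , as) | inj₂ uW = inj₂ (u , uW)
  solid-geodesic-monotone (ad ∷ [] _) geo (inj₁ d , as) | inj₂ _ = inj₁ (d , tt)
  solid-geodesic-monotone (ad ∷ (ad' ∷ W)) geo (inj₁ d , as) | inj₂ (up , _)
    with edge-by-child w𝒯 (proj₁ (proj₂ ad')) (proj₁ ad) (trans up (sym d))
  ... | refl = ⊥-elim (ℕₚ.1+n≰n (ℕₚ.≤-trans (ℕₚ.n≤1+n _) (geo W)))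
  solid-geodesic-monotone (ad ∷ [] _) geo (inj₂ u , as) | inj₁ _ = inj₂ (u , tt)
  solid-geodesic-monotone (_∷_ {e} ad (_∷_ {f = h} ad' W)) geo (inj₂ u , as) | inj₁ (down , _) with e ≟E h
  ... | yes refl = ⊥-elim (ℕₚ.1+n≰n (ℕₚ.≤-trans (ℕₚ.n≤1+n _) (geo W)))
  ... | no ne = ⊥-elim (ℕₚ.1+n≰n (geo ((proj₁ ad , proj₁ (proj₂ ad') , ne , inj₁ (trans (sym u) down)) ∷ W)))

  down⇒anc : ∀ {e g f} (ad : Adj 𝒯 e g) (W : Walk 𝒯 g f) → Down (ad ∷ W) → Anc (edges 𝒯) (proj₂ e) (proj₁ f)
  down⇒anc ad ([] _) (x , _) = 0 , subst (λ z → Chain _ _ z 0) x stay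
  down⇒anc {e} ad (ad' ∷ W) (x , d) =
    let (n , r) = down⇒anc ad' W d in
    suc n , link (subst (λ z → (z , _) ∈ edges 𝒯) (sym x) (proj₁ ad')) r

  up⇒anc : ∀ {e g f} (ad : Adj 𝒯 e g) (W : Walk 𝒯 g f) → Up (ad ∷ W) → Anc (edges 𝒯) (proj₂ f) (proj₁ e)
  up⇒anc ad ([] _) (x , _) = 0 , subst (λ z → Chain _ _ z 0) x stay
  up⇒anc {e} {g} ad (ad' ∷ W) (x , d) =
    let (n , r) = up⇒anc ad' W d in
    suc n , chain-snoc r (subst (λ z → (_ , z) ∈ edges 𝒯) x (proj₁ (proj₂ ad)))

  solid-geodesic⇒anc : ∀ {u v} → u ≢ v → (P : Walk 𝒯 u v) → Geodesic P → AllSolid P →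
                       Anc (edges 𝒯) (proj₂ u) (proj₁ v) ⊎ Anc (edges 𝒯) (proj₂ v) (proj₁ u)
  solid-geodesic⇒anc u≢v ([] _) _ _ = ⊥-elim (u≢v refl)
  solid-geodesic⇒anc u≢v (ad ∷ W) geo as with solid-geodesic-monotone (ad ∷ W) geo as
  ... | inj₁ d = inj₁ (down⇒anc ad W d)
  ... | inj₂ u = inj₂ (up⇒anc ad W u)

-- A grafting relation of Φ⁻¹(Vu) is a Below relation of Vu, hence of
-- E (monotonicity), hence of Vv (reflection), hence a grafting relation of
-- Φ⁻¹(Vv); for x = u we pass through v, which shares u's label in E.
module FromConstructs (𝒯 : Tree) (w𝒯 : Distinct 𝒯) {E Vu Vv : Cons TEdge} {u v : TEdge} (u≢v : u ≢ v) where
  open Hypergraph _≟E_ (𝔾 𝒯)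
  open Constructs _≟E_ (𝔾 𝒯) hiding (Occurs; label; inChild; Below; top; sub)
  open Descent 𝒯 w𝒯 u v u≢v using (Matched)

  matched : IsConstruct (edges 𝒯) E → OneDoubleton u v E →
            IsConstruction (edges 𝒯) Vu → edges 𝒯 ⊢ Vu ≤ E → ParentOf u v Vu →
            IsConstruction (edges 𝒯) Vv → edges 𝒯 ⊢ Vv ≤ E → ParentOf v u Vv →
            ∀ {u₁ u₂ v₁ v₂} (au : Admissible (u₁ · u₂) 𝒯) → Φ au ≈ Vu →
            (av : Admissible (v₁ · v₂) 𝒯) → Φ av ≈ Vv → Matched au av
  matched cE od (cVu , sVu) Vu≤E u↑v (cVv , sVv) Vv≤E v↑u au Φau≈Vu av Φav≈Vv = record
    { similar = record { distinct-S = w𝒯 ; distinct-S' = w𝒯 ; same-shape = refl , (λ q → q) , (λ q → q)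
                       ; transfer = λ nu nv _ b → to-v (V.reflect-other nv nu (in-E-u b)) }
    ; transfer' = λ nu nv _ b → to-u (U.reflect-other nu nv (in-E-v b))
    ; u↦v = λ b → to-v (V.reflect-u (below-u⇒below-v cE od (in-E-u b)))
    ; in𝒯 = λ q → q }
    where
      v-not-above-u : ¬ Below Vu v u
      v-not-above-u b = u≢v (singleton-sameNode sVu (below-antisym cVu (parent⇒below u↑v) b))
      u-not-above-v : ¬ Below Vv u v
      u-not-above-v b = u≢v (sym (singleton-sameNode sVv (below-antisym cVv (parent⇒below v↑u) b)))
      module U = Reflect cE od cVu Vu≤E v-not-above-u
      module V = Reflect cE (doubleton-sym od) cVv Vv≤E u-not-above-v
      in-E-u : ∀ {x y} → Grafted au x y → Below E x y
      in-E-u b = below-mono Vu≤E (below-≈ Φau≈Vu (grafted⇒Φ-below au b))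
      in-E-v : ∀ {x y} → Grafted av x y → Below E x y
      in-E-v b = below-mono Vv≤E (below-≈ Φav≈Vv (grafted⇒Φ-below av b))
      to-u : ∀ {x y} → Below Vu x y → Grafted au x y
      to-u b = Φ-below⇒grafted au (below-≈⁻ Φau≈Vu b)
      to-v : ∀ {x y} → Below Vv x y → Grafted av x y
      to-v b = Φ-below⇒grafted av (below-≈⁻ Φav≈Vv b)

  parent-position : ∀ {a b w₁ w₂ V} (α : Admissible (w₁ · w₂) 𝒯) → Φ α ≈ V → ParentOf a b V → ParentPos a b α
  parent-position α Φα≈V p = parentPos α (parentOf-≈⁻ Φα≈V p)

conclusion : ∀ 𝒯 (w𝒯 : Distinct 𝒯) {u v} (u≢v : u ≢ v) {wu wv} → Descent.Outcome 𝒯 w𝒯 u v u≢v wu wv →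
             (P : Walk 𝒯 u v) → Geodesic P →
             (AllSolid P →
                Σ ℕ λ du → Σ ℕ λ dv → Level 𝒯 u du × Level 𝒯 v dv × du ≢ dv ×
                  (du < dv → AssocStep wv wu) × (dv < du → AssocStep wu wv))
             × (¬ AllSolid P → TwistStep wu wv ⊎ TwistStep wv wu)
conclusion 𝒯 w𝒯 u≢v (Descent.assocUV step d) P geo =
  let (du , dv , lu , lv , du<dv , solid) = descent⇒solid d P geo
  in (λ _ → du , dv , lu , lv , ℕₚ.<⇒≢ du<dv , (λ _ → step) , (λ dv<du → ⊥-elim (ℕₚ.<-asym du<dv dv<du))) ,
     (λ not-solid → ⊥-elim (not-solid solid))
  where open Geometry 𝒯 w𝒯
conclusion 𝒯 w𝒯 u≢v (Descent.assocVU step d) P geo =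
  let (du , dv , lu , lv , dv<du , solid) = ascent⇒solid d P geo
  in (λ _ → du , dv , lu , lv , ℕₚ.<⇒≢ dv<du ∘ sym , (λ du<dv → ⊥-elim (ℕₚ.<-asym dv<du du<dv)) , (λ _ → step)) ,
     (λ not-solid → ⊥-elim (not-solid solid))
  where open Geometry 𝒯 w𝒯
conclusion 𝒯 w𝒯 u≢v (Descent.twist step nd₁ nd₂) P geo =
  (λ solid → ⊥-elim ([ nd₁ , nd₂ ]′ (solid-geodesic⇒anc u≢v P geo solid))) , (λ _ → inj₁ step)
  where open Geometry 𝒯 w𝒯

theorem2 : (𝒯 : Tree) → Unique (letters 𝒯) → edges 𝒯 ≢ [] →
    let open Hypergraph _≟E_ (𝔾 𝒯) in
    (E : Cons TEdge) → IsConstruct (edges 𝒯) E →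
    (u v : TEdge) → u ≢ v → OneDoubleton u v E →
    (Vu Vv : Cons TEdge) →
    IsConstruction (edges 𝒯) Vu → edges 𝒯 ⊢ Vu ≤ E → ParentOf u v Vu →
    IsConstruction (edges 𝒯) Vv → edges 𝒯 ⊢ Vv ≤ E → ParentOf v u Vv →
    {u₁ u₂ v₁ v₂ : Word} →
    (au : Admissible (u₁ · u₂) 𝒯) → Φ au ≈ Vu →
    (av : Admissible (v₁ · v₂) 𝒯) → Φ av ≈ Vv →
    (P : Walk 𝒯 u v) → Geodesic P →
    (AllSolid P →
       Σ ℕ λ du → Σ ℕ λ dv → Level 𝒯 u du × Level 𝒯 v dv × du ≢ dv ×
         (du < dv → AssocStep (v₁ · v₂) (u₁ · u₂)) ×
         (dv < du → AssocStep (u₁ · u₂) (v₁ · v₂)))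
    × (¬ AllSolid P →
         TwistStep (u₁ · u₂) (v₁ · v₂) ⊎ TwistStep (v₁ · v₂) (u₁ · u₂))
theorem2 𝒯 unique _ E cE u v u≢v od Vu Vv cVu Vu≤E u↑v cVv Vv≤E v↑u au Φau≈Vu av Φav≈Vv P geo =
  conclusion 𝒯 w𝒯 u≢v
    (descend au av (matched cE od cVu Vu≤E u↑v cVv Vv≤E v↑u au Φau≈Vu av Φav≈Vv)
             (parent-position au Φau≈Vu u↑v) (parent-position av Φav≈Vv v↑u))
    P geo
  where
    w𝒯 = unique⇒distinct 𝒯 unique
    open Descent 𝒯 w𝒯 u v u≢v using (descend)
    open FromConstructs 𝒯 w𝒯 u≢v
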